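{- Let $m,k\in\mathbb Z^+$ with $k\geqslant m$, let $a_1,\ldots,a_k\in\mathbb Z$ and $n_1\leqslant n_2\leqslant\cdots\leqslant n_k$ be positive integers, and suppose $\{a_s(n_s)\}_{s=1}^k$ is an $m$-system, i.e. every $x\in\mathbb Z$ satisfies $|\{1\leqslant s\leqslant k: x\equiv a_s\pmod{n_s}\}|\leqslant m$. Suppose $\sum_{s=1}^k1/n_s\neq m$. Then $$\sum_{s=1}^k\frac1{n_s}\leqslant m-\frac1{2^{k-m+1}},$$ and equality holds if and only if $n_s=2^{\max\{s-m+1,0\}}$ for all $s=1,\ldots,k$.
   Context: $a(n)=\{x\in\mathbb Z:x\equiv a\pmod n\}$. -}

module Defs where

open import Data.Nat using (ℕ; zero; suc)
open import Data.Integer using (ℤ; +_; _-_)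
open import Data.Integer.Divisibility using (_∣_)
open import Data.Integer.DivMod using ()
open import Data.Fin using (Fin)
open import Data.List using (List; length; filter; allFin; foldr; map)
open import Data.Rational using (ℚ; 0ℚ; _+_; _/_)
open import Relation.Unary using (Pred; Decidable)

import Data.Integer.Divisibility.Signed as S
import Data.Integer.Properties as ℤP
open import Data.Nat.Divisibility using () renaming (_∣?_ to _∣ℕ?_)
open import Relation.Nullary using (Dec; yes; no)
import Relation.Nullary.Decidable as Dec
open import Data.Integer using (∣_∣)

-- (n : ℤ) ∣ x is, in the stdlib, ∣ n ∣ ∣ ∣ x ∣ in ℕ
_∣ℤ?_ : (d x : ℤ) → Dec (d ∣ x)
d ∣ℤ? x = Dec.map′ (λ p → p) (λ p → p) (∣ d ∣ ∣ℕ? ∣ x ∣)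

_≡_[mod_] : ℤ → ℤ → ℕ → Set
x ≡ a [mod n ] = (+ n) ∣ (x - a)

_≡?_[mod_] : (x a : ℤ) (n : ℕ) → Dec (x ≡ a [mod n ])
x ≡? a [mod n ] = (+ n) ∣ℤ? (x - a)

coverCount : {k : ℕ} → (Fin k → ℤ) → (Fin k → ℕ) → ℤ → ℕ
coverCount {k} a n x = length (filter (λ s → x ≡? a s [mod n s ]) (allFin k))

IsMSystem : (m : ℕ) {k : ℕ} → (Fin k → ℤ) → (Fin k → ℕ) → Set
IsMSystem m a n = ∀ (x : ℤ) → coverCount a n x Data.Nat.≤ m

-- 1/n as a rational (only used for n ≥ 1; 1/0 := 0 is a junk value)
recip : ℕ → ℚ
recip zero    = 0ℚ
recip (suc d) = (+ 1) / suc d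

sumRecip : {k : ℕ} → (Fin k → ℕ) → ℚ
sumRecip {k} n = foldr _+_ 0ℚ (map (λ s → recip (n s)) (allFin k))

-- Let M be a common multiple of the moduli, with cofactors u s = M / n s, so that Σ 1/n s = T/M where
-- T = Σ u s counts, with multiplicity, the classes containing each point of [0, M).  If T ≠ mM then,
-- as no point lies in more than m classes, some x₀ lies in at most m − 1 of them, and k − m + 1
-- classes avoid x₀.  Any r classes avoiding a point avoid at least M/2^r points of [0, M): write
-- M = pN′ with p prime and fibre ℤ/pN′ over ℤ/N′.  The classes whose image in ℤ/N′ contains the
-- image y₀ of x₀ meet each fibre at most once each, and together meet any fibre in at most as many
-- points, e < p, as the fibre over y₀; the other classes are replaced by their images, which avoid
-- y₀.  By induction on N′, at least N′/2^(r−e) fibres keep p − e ≥ p/2^e avoided points each.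
-- Every point avoided by the k − m + 1 classes lies in at most m − 1 classes, whence
-- T ≤ mM − M/2^(k−m+1).
-- In the case of equality 2^(k−m+1) divides every common multiple and hence some modulus, so the
-- largest modulus n_k is at least 2^(k−m+1); the bound for the first k − 1 classes gives
-- n_k ≤ 2^(k−m+1), and the first k − 1 classes are extremal again.

module Submission where

open import Defs

open import Data.Bool.Base using (Bool; true; false; T)
open import Data.Empty using (⊥)
open import Data.Fin.Base
  using (Fin; zero; suc; toℕ; fromℕ; fromℕ<; inject₁; _↑ˡ_; _↑ʳ_; combine; remQuot)
  renaming (_≤_ to _≤ᶠ_)
import Data.Fin.Properties as Finₚ
open import Data.Integer.Base as ℤ using (ℤ; +_; ∣_∣; _%ℕ_; _/ℕ_)
import Data.Integer.Properties as ℤₚ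
open import Data.Integer.DivMod using (a≡a%ℕn+[a/ℕn]*n; n%ℕd<d)
open import Data.Integer.Divisibility.Signed as ℤ∣ using (∣ᵤ⇒∣; ∣⇒∣ᵤ)
  renaming (_∣_ to _∣ℤ_)
import Data.Integer.Tactic.RingSolver as ℤ-Ring
open import Data.List.Base using (List; []; _∷_; length; filter; map; foldr; tabulate; allFin)
open import Data.List.Membership.Propositional.Properties using (∈-filter⁺; ∈-allFin; ∈-tabulate⁺)
open import Data.List.Properties using (length-map)
open import Data.List.Relation.Unary.All as All using (All; []; _∷_; all?)
open import Data.List.Relation.Unary.All.Properties
  using (all-filter; filter⁺; map⁺; map⁻; tabulate⁺; ¬Any⇒All¬; All¬⇒¬Any)
open import Data.List.Relation.Unary.Any as Any using (Any; here; there; any?; toSum)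
open import Data.Nat.Base
  using (ℕ; zero; suc; _+_; _*_; _∸_; _^_; _≤_; _<_; _⊔_; z≤n; s≤s;
         NonZero; >-nonZero; ≢-nonZero; ≢-nonZero⁻¹; nonTrivial⇒n>1)
open import Data.Nat.Divisibility
  using (_∣_; _∣?_; divides; ∣-refl; ∣-trans; ∣-antisym; _∣0; ∣⇒≤;
         ∣m⇒∣m*n; ∣n⇒∣m*n; n∣m*n; m∣m*n; *-pres-∣; *-cancelˡ-∣; ∣m+n∣m⇒∣n)
open import Data.Nat.GCD using (gcd; gcd-GCD; gcd[m,n]∣m; gcd[m,n]∣n; gcd-greatest; module Bézout)
open import Data.Nat.Induction using (<-rec)
open import Data.Nat.ListAction using (product)
open import Data.Nat.ListAction.Properties using (∈⇒∣product; product≢0)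
open import Data.Nat.Primality
  using (Prime; euclidsLemma; prime⇒nonZero; prime⇒nonTrivial; prime[2]; productOfPrimes≢0)
open import Data.Nat.Primality.Factorisation using (factorise; PrimeFactorisation)
open import Data.Nat.Properties
import Data.Nat.Tactic.RingSolver as ℕ-Ring
open import Data.Product as Product using (∃; ∃₂; _×_; _,_; proj₁; proj₂)
open import Data.Rational.Base as ℚ using (ℚ; 0ℚ; _-_; _/_) renaming (_≤_ to _≤ℚ_)
import Data.Rational.Properties as ℚₚ
open import Data.Rational.Unnormalised.Base as ℚᵘ using (ℚᵘ; *≡*; *≤*)
  renaming (_≃_ to _≃ᵘ_; _≤_ to _≤ᵘ_)
import Data.Rational.Unnormalised.Properties as ℚᵘₚ
open import Data.Sum using (_⊎_; inj₁; inj₂)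
open import Data.Unit using (⊤; tt)
open import Data.Vec.Functional using (init; last)
open import Function using (_∘_; _⇔_; mk⇔; Equivalence)
open import Level using (Level)
open import Relation.Binary.PropositionalEquality
open import Relation.Nullary using (Dec; yes; no; ¬_; ¬?; contradiction; _×-dec_)
open import Relation.Nullary.Decidable using (T?; map′)
open import Relation.Unary using (Pred; Decidable)

open import Algebra.Properties.Semiring.Sum +-*-semiring
  using (sum; sum-syntax; sum-cong-≗; sum-init-last; ∑-distrib-+; ∑-comm; *-distribˡ-sum; *-distribʳ-sum)

private
  variable
    ℓ ℓ₁ ℓ₂ ℓ₃ : Level
    A : Set ℓ₁
    B : Set ℓ₂
    C : Set ℓ₃
    k n : ℕ

*-≡-nonZeroˡ : ∀ {m} n {o} .{{_ : NonZero o}} → m * n ≡ o → NonZero m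
*-≡-nonZeroˡ n refl = m*n≢0⇒m≢0 _

*-≡-nonZeroʳ : ∀ m {n o} .{{_ : NonZero o}} → m * n ≡ o → NonZero n
*-≡-nonZeroʳ m refl = m*n≢0⇒n≢0 m

m+n≤2^m*n : ∀ m {n} → 1 ≤ n → m + n ≤ 2 ^ m * n
m+n≤2^m*n zero    {n} _   = ≤-reflexive (sym (+-identityʳ n))
m+n≤2^m*n (suc m) {n} 1≤n = begin
  suc (m + n)                  ≤⟨ +-monoˡ-≤ (m + n) (≤-trans 1≤n (m≤n+m n m)) ⟩
  (m + n) + (m + n)            ≤⟨ +-mono-≤ ih ih ⟩
  2 ^ m * n + 2 ^ m * n        ≡⟨ cong (_+_ (2 ^ m * n)) (sym (+-identityʳ (2 ^ m * n))) ⟩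
  2 * (2 ^ m * n)              ≡⟨ *-assoc 2 (2 ^ m) n ⟨
  2 ^ suc m * n                ∎
  where
  open ≤-Reasoning
  ih = m+n≤2^m*n m 1≤n

^-monoʳ-∣ : ∀ p {v e} → v ≤ e → p ^ v ∣ p ^ e
^-monoʳ-∣ p {v} {e} v≤e =
  subst (p ^ v ∣_) (trans (sym (^-distribˡ-+-* p v (e ∸ v))) (cong (p ^_) (m+[n∸m]≡n v≤e)))
        (m∣m*n _)

prime∣*⇒∣ : ∀ {p m q} → Prime p → ¬ p ∣ q → p ∣ m * q → p ∣ m
prime∣*⇒∣ {m = m} {q} p-prime p∤q p∣mq with euclidsLemma m q p-prime p∣mq
... | inj₁ p∣m = p∣m
... | inj₂ p∣q = contradiction p∣q p∤q

prime∤product : ∀ {p os} → Prime p → All (λ o → ¬ p ∣ o) os → ¬ p ∣ product os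
prime∤product p-prime []          p∣1    =
  contradiction (∣⇒≤ p∣1) (<⇒≱ (nonTrivial⇒n>1 _ {{prime⇒nonTrivial p-prime}}))
prime∤product p-prime (p∤o ∷ p∤os) p∣o*os with euclidsLemma _ _ p-prime p∣o*os
... | inj₁ p∣o  = p∤o p∣o
... | inj₂ p∣os = prime∤product p-prime p∤os p∣os

p-adic : ∀ {p} → Prime p → ∀ n → 1 ≤ n → ∃₂ λ v o → n ≡ p ^ v * o × ¬ p ∣ o
p-adic {p} p-prime = <-rec _ decompose
  where
  decompose : ∀ n → (∀ {q} → q < n → 1 ≤ q → ∃₂ λ v o → q ≡ p ^ v * o × ¬ p ∣ o) →
    1 ≤ n → ∃₂ λ v o → n ≡ p ^ v * o × ¬ p ∣ o
  decompose n rec 1≤n with p ∣? n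
  ... | no p∤n = 0 , n , sym (+-identityʳ n) , p∤n
  ... | yes (divides q n≡qp) =
    let v , o , q≡ , p∤o = rec q<n 1≤q in suc v , o , trans n≡qp (step v o q≡) , p∤o
    where
    1≤q : 1 ≤ q
    1≤q = n≢0⇒n>0 (λ q≡0 → <⇒≢ 1≤n (sym (trans n≡qp (cong (_* p) q≡0))))
    q<n : q < n
    q<n = subst (q <_) (sym n≡qp)
            (m<m*n q p {{>-nonZero 1≤q}} (nonTrivial⇒n>1 p {{prime⇒nonTrivial p-prime}}))
    step : ∀ v o → q ≡ p ^ v * o → q * p ≡ p ^ suc v * o
    step v o refl = rearrange (p ^ v) o p
      where
      rearrange : ∀ a o p → a * o * p ≡ p * a * o
      rearrange = ℕ-Ring.solve-∀

m+n≡o⇒+m≡+o-+n : ∀ {g a b} → g + a ≡ b → + g ≡ + b ℤ.- + a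
m+n≡o⇒+m≡+o-+n {g} {a} refl = sym (trans (cong (ℤ._- + a) (ℤₚ.pos-+ g a)) (cancel (+ g) (+ a)))
  where
  cancel : ∀ g a → g ℤ.+ a ℤ.- a ≡ g
  cancel = ℤ-Ring.solve-∀

bézout : ∀ m n → ∃₂ λ u v → + gcd m n ≡ u ℤ.* (+ m) ℤ.+ v ℤ.* (+ n)
bézout m n with Bézout.identity (gcd-GCD m n)
... | Bézout.+- x y eq = + x , ℤ.- (+ y) ,
  trans (m+n≡o⇒+m≡+o-+n eq)
        (trans (cong₂ ℤ._-_ (ℤₚ.pos-* x m) (ℤₚ.pos-* y n)) (rearrange (+ x) (+ m) (+ y) (+ n)))
  where
  rearrange : ∀ x m y n → x ℤ.* m ℤ.- y ℤ.* n ≡ x ℤ.* m ℤ.+ (ℤ.- y) ℤ.* n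
  rearrange = ℤ-Ring.solve-∀
... | Bézout.-+ x y eq = ℤ.- (+ x) , + y ,
  trans (m+n≡o⇒+m≡+o-+n eq)
        (trans (cong₂ ℤ._-_ (ℤₚ.pos-* y n) (ℤₚ.pos-* x m)) (rearrange (+ y) (+ n) (+ x) (+ m)))
  where
  rearrange : ∀ y n x m → y ℤ.* n ℤ.- x ℤ.* m ≡ (ℤ.- x) ℤ.* m ℤ.+ y ℤ.* n
  rearrange = ℤ-Ring.solve-∀

[x∸1]*y+y≡x*y : ∀ {x} M → 1 ≤ x → (x ∸ 1) * M + M ≡ x * M
[x∸1]*y+y≡x*y {x} M 1≤x = trans (cong (_+_ ((x ∸ 1) * M)) (sym (*-identityˡ M)))
                      (trans (sym (*-distribʳ-+ M (x ∸ 1) 1)) (cong (_* M) (m∸n+n≡m 1≤x)))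

[k∸m]+1≡1+k∸m : ∀ {k m} → m ≤ k → (k ∸ m) + 1 ≡ suc k ∸ m
[k∸m]+1≡1+k∸m {k} {m} m≤k = sym (trans (cong (_∸ m) (+-comm 1 k)) (+-∸-comm 1 m≤k))

sum-mono-≤ : {f g : Fin n → ℕ} → (∀ i → f i ≤ g i) → sum f ≤ sum g
sum-mono-≤ {zero}  _   = z≤n
sum-mono-≤ {suc n} f≤g = +-mono-≤ (f≤g zero) (sum-mono-≤ (f≤g ∘ suc))

sum-const : ∀ n x → ∑[ i < n ] x ≡ n * x
sum-const zero    x = refl
sum-const (suc n) x = cong (_+_ x) (sum-const n x)

sum-↑ : ∀ m (f : Fin (m + n) → ℕ) → sum f ≡ ∑[ i < m ] f (i ↑ˡ n) + ∑[ j < n ] f (m ↑ʳ j)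
sum-↑ zero    f = refl
sum-↑ (suc m) f = trans (cong (_+_ (f zero)) (sum-↑ m (f ∘ suc))) (sym (+-assoc (f zero) _ _))

sum-combine : ∀ m (f : Fin (m * n) → ℕ) → sum f ≡ ∑[ i < m ] ∑[ j < n ] f (combine i j)
sum-combine             zero    f = refl
sum-combine {n = n} (suc m) f =
  trans (sum-↑ n f) (cong (_+_ (∑[ j < n ] f (j ↑ˡ m * n))) (sum-combine m (f ∘ (n ↑ʳ_))))

sum≡n*x⇒≡x : ∀ {f : Fin n → ℕ} {x} → (∀ i → f i ≤ x) → sum f ≡ n * x → ∀ i → f i ≡ x
sum≡n*x⇒≡x {suc n} {f} {x} f≤x sum≡ = λ where
    zero    → head≡
    (suc i) → sum≡n*x⇒≡x (f≤x ∘ suc) (+-cancelˡ-≡ x _ _ (trans (cong (_+ _) (sym head≡)) sum≡)) i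
  where
  tail≤ : sum (f ∘ suc) ≤ n * x
  tail≤ = ≤-trans (sum-mono-≤ (f≤x ∘ suc)) (≤-reflexive (sum-const n x))
  head≡ : f zero ≡ x
  head≡ = ≤-antisym (f≤x zero) (+-cancelʳ-≤ (n * x) x (f zero)
            (≤-trans (≤-reflexive (sym sum≡)) (+-monoʳ-≤ (f zero) tail≤)))

𝟙 : Dec A → ℕ
𝟙 (yes _) = 1
𝟙 (no _)  = 0

𝟙-yes : (A? : Dec A) → A → 𝟙 A? ≡ 1
𝟙-yes (yes _) _ = refl
𝟙-yes (no ¬a) a = contradiction a ¬a

𝟙-no : (A? : Dec A) → ¬ A → 𝟙 A? ≡ 0
𝟙-no (yes a) ¬a = contradiction a ¬a
𝟙-no (no _)  _  = refl

𝟙-cong : (A? : Dec A) (B? : Dec B) → (A → B) → (B → A) → 𝟙 A? ≡ 𝟙 B?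
𝟙-cong (yes _) (yes _) _   _   = refl
𝟙-cong (yes a) (no ¬b) A→B _   = contradiction (A→B a) ¬b
𝟙-cong (no ¬a) (yes b) _   B→A = contradiction (B→A b) ¬a
𝟙-cong (no _)  (no _)  _   _   = refl

𝟙≤1 : (A? : Dec A) → 𝟙 A? ≤ 1
𝟙≤1 (yes _) = ≤-refl
𝟙≤1 (no _)  = z≤n

𝟙-⊎ : (A? : Dec A) (B? : Dec B) (C? : Dec C) → (A → B ⊎ C) → 𝟙 A? ≤ 𝟙 B? + 𝟙 C?
𝟙-⊎ (no _)  _       _       _ = z≤n
𝟙-⊎ (yes _) (yes _) _       _ = s≤s z≤n
𝟙-⊎ (yes _) (no _)  (yes _) _ = ≤-refl
𝟙-⊎ (yes a) (no ¬b) (no ¬c) f with f a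
... | inj₁ b = contradiction b ¬b
... | inj₂ c = contradiction c ¬c

𝟙-disjoint : (A? : Dec A) (B? : Dec B) → (A → B → ⊥) → 𝟙 A? + 𝟙 B? ≤ 1
𝟙-disjoint (yes a) (yes b) disj = contradiction b (disj a)
𝟙-disjoint (yes _) (no _)  _    = ≤-refl
𝟙-disjoint (no _)  B?      _    = 𝟙≤1 B?

𝟙-∁ : (A? : Dec A) → 𝟙 A? + 𝟙 (¬? A?) ≡ 1
𝟙-∁ (yes _) = refl
𝟙-∁ (no _)  = refl

count : {P : Pred (Fin n) ℓ} → Decidable P → ℕ
count {n} P? = ∑[ i < n ] 𝟙 (P? i)

count-≡0 : {P : Pred (Fin n) ℓ₁} (P? : Decidable P) → (∀ i → ¬ P i) → count P? ≡ 0
count-≡0 {n} P? ¬P = trans (sum-cong-≗ (λ i → 𝟙-no (P? i) (¬P i))) (trans (sum-const n 0) (*-zeroʳ n))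

count≥1 : {P : Pred (Fin n) ℓ₁} (P? : Decidable P) → ∀ i → P i → 1 ≤ count P?
count≥1 P? zero    p = ≤-trans (≤-reflexive (sym (𝟙-yes (P? zero) p))) (m≤m+n _ _)
count≥1 P? (suc i) p = ≤-trans (count≥1 (P? ∘ suc) i p) (m≤n+m _ (𝟙 (P? zero)))

count≤1 : {P : Pred (Fin n) ℓ₁} (P? : Decidable P) → (∀ {i j} → P i → P j → i ≡ j) → count P? ≤ 1
count≤1 {zero}  P? _    = z≤n
count≤1 {suc n} P? uniq with P? zero
... | yes p = ≤-reflexive (cong suc (count-≡0 (P? ∘ suc) (λ i q → 0≢1+n (cong toℕ (uniq p q)))))
... | no _  = count≤1 (P? ∘ suc) (λ p q → Finₚ.suc-injective (uniq p q))

count≤n : {P : Pred (Fin n) ℓ₁} (P? : Decidable P) → count P? ≤ n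
count≤n {n} P? = ≤-trans (sum-mono-≤ (𝟙≤1 ∘ P?)) (≤-reflexive (trans (sum-const n 1) (*-identityʳ n)))

count<n : {P : Pred (Fin n) ℓ₁} (P? : Decidable P) → ∀ i → ¬ P i → count P? < n
count<n P? zero    ¬p rewrite 𝟙-no (P? zero) ¬p = s≤s (count≤n (P? ∘ suc))
count<n P? (suc i) ¬p = +-mono-≤-< (𝟙≤1 (P? zero)) (count<n (P? ∘ suc) i ¬p)

count-⊎ : {P : Pred (Fin n) ℓ₁} {Q : Pred (Fin n) ℓ₂} {R : Pred (Fin n) ℓ₃}
  (P? : Decidable P) (Q? : Decidable Q) (R? : Decidable R) →
  (∀ i → P i → Q i ⊎ R i) → count P? ≤ count Q? + count R?
count-⊎ P? Q? R? f = ≤-trans (sum-mono-≤ (λ i → 𝟙-⊎ (P? i) (Q? i) (R? i) (f i)))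
                              (≤-reflexive (∑-distrib-+ (𝟙 ∘ Q?) (𝟙 ∘ R?)))

count-cover : {Q : Pred (Fin n) ℓ₂} {R : Pred (Fin n) ℓ₃} (Q? : Decidable Q) (R? : Decidable R) →
  (∀ i → Q i ⊎ R i) → n ≤ count Q? + count R?
count-cover {n} Q? R? f = ≤-trans (≤-reflexive (sym (trans (sum-const n 1) (*-identityʳ n))))
                                  (count-⊎ {P = λ _ → ⊤} (λ _ → yes tt) Q? R? (λ i _ → f i))

count-disjoint : {P : Pred (Fin n) ℓ₁} {Q : Pred (Fin n) ℓ₂} (P? : Decidable P) (Q? : Decidable Q) →
  (∀ i → P i → Q i → ⊥) → count P? + count Q? ≤ n
count-disjoint {n} P? Q? disj =
  ≤-trans (≤-reflexive (sym (∑-distrib-+ (𝟙 ∘ P?) (𝟙 ∘ Q?))))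
    (≤-trans (sum-mono-≤ (λ i → 𝟙-disjoint (P? i) (Q? i) (disj i)))
      (≤-reflexive (trans (sum-const n 1) (*-identityʳ n))))

count-∁ : {P : Pred (Fin n) ℓ₁} (P? : Decidable P) → count P? + count (¬? ∘ P?) ≡ n
count-∁ {n} P? = trans (sym (∑-distrib-+ (𝟙 ∘ P?) (𝟙 ∘ ¬? ∘ P?)))
  (trans (sum-cong-≗ (𝟙-∁ ∘ P?)) (trans (sum-const n 1) (*-identityʳ n)))

count-any≤length : {P : A → Pred (Fin n) ℓ₁} (P? : ∀ x → Decidable (P x)) (xs : List A) →
  All (λ x → count (P? x) ≤ 1) xs → count (λ i → any? (λ x → P? x i) xs) ≤ length xs
count-any≤length P? []       []         = ≤-reflexive (count-≡0 (λ i → any? (λ x → P? x i) []) (λ _ ()))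
count-any≤length P? (x ∷ xs) (≤1 ∷ ≤1s) =
  ≤-trans (count-⊎ _ (P? x) (λ i → any? (λ x → P? x i) xs) (λ _ → toSum))
          (+-mono-≤ ≤1 (count-any≤length P? xs ≤1s))

count-≤-by-relation : {P : Pred (Fin k) ℓ₁} {Q : Pred (Fin n) ℓ₂} {R : Fin k → Fin n → Set ℓ₃}
  (P? : Decidable P) (Q? : Decidable Q) (R? : ∀ i j → Dec (R i j)) →
  (∀ j → Q j → ∃ λ i → R i j) → (∀ {i j} → R i j → P i) →
  (∀ {i j j′} → R i j → R i j′ → j ≡ j′) →
  count Q? ≤ count P?
count-≤-by-relation {k = k} {n = n} P? Q? R? Q⇒R R⇒P R-functional = begin
  count Q?                                ≤⟨ sum-mono-≤ Q≤R ⟩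
  ∑[ j < n ] ∑[ i < k ] 𝟙 (R? i j)        ≡⟨ ∑-comm (λ j i → 𝟙 (R? i j)) ⟩
  ∑[ i < k ] count (R? i)                 ≤⟨ sum-mono-≤ R≤P ⟩
  count P?                                ∎
  where
  open ≤-Reasoning
  Q≤R : ∀ j → 𝟙 (Q? j) ≤ ∑[ i < k ] 𝟙 (R? i j)
  Q≤R j with Q? j
  ... | no _  = z≤n
  ... | yes q = let i , r = Q⇒R j q in count≥1 (λ i → R? i j) i r
  R≤P : ∀ i → count (R? i) ≤ 𝟙 (P? i)
  R≤P i with P? i
  ... | yes _ = count≤1 (R? i) R-functional
  ... | no ¬p = ≤-reflexive (count-≡0 (R? i) (λ j r → ¬p (R⇒P r)))

subset-of-size : {P : Pred (Fin n) ℓ₁} (P? : Decidable P) → ∀ m → m ≤ count P? →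
  ∃ λ (J : Fin n → Bool) → (∀ i → T (J i) → P i) × count (T? ∘ J) ≡ m
subset-of-size {zero}  P? zero    _ = (λ ()) , (λ ()) , refl
subset-of-size {suc n} P? zero    _ = (λ _ → false) , (λ _ ()) , count-≡0 {n = suc n} (λ _ → T? false) (λ _ ())
subset-of-size {suc n} P? (suc m) m<count with P? zero
... | yes p = let J , J⊆P , count≡ = subset-of-size (P? ∘ suc) m (≤-pred m<count) in
  (λ { zero → true ; (suc i) → J i }) , (λ { zero _ → p ; (suc i) → J⊆P i }) , cong suc count≡
... | no _  = let J , J⊆P , count≡ = subset-of-size (P? ∘ suc) (suc m) m<count in
  (λ { zero → false ; (suc i) → J i }) , (λ { zero () ; (suc i) → J⊆P i }) , count≡

length-filter-tabulate : {P : Pred A ℓ₁} (P? : Decidable P) (f : Fin n → A) →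
  length (filter P? (tabulate f)) ≡ count (P? ∘ f)
length-filter-tabulate {n = zero}  P? f = refl
length-filter-tabulate {n = suc n} P? f with P? (f zero)
... | yes _ = cong suc (length-filter-tabulate P? (f ∘ suc))
... | no _  = length-filter-tabulate P? (f ∘ suc)

length-filter+filter-∁ : {P : Pred A ℓ₁} (P? : Decidable P) (xs : List A) →
  length (filter P? xs) + length (filter (¬? ∘ P?) xs) ≡ length xs
length-filter+filter-∁ P? []       = refl
length-filter+filter-∁ P? (x ∷ xs) with P? x
... | yes _ = cong suc (length-filter+filter-∁ P? xs)
... | no _  = trans (+-suc _ _) (cong suc (length-filter+filter-∁ P? xs))

All-filter+filter-∁ : {P : Pred A ℓ₁} {Q : Pred A ℓ₂} (P? : Decidable P) (xs : List A) →
  All Q (filter P? xs) → All Q (filter (¬? ∘ P?) xs) → All Q xs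
All-filter+filter-∁ P? []       _          _          = []
All-filter+filter-∁ P? (x ∷ xs) Qs         Qs′        with P? x
All-filter+filter-∁ P? (x ∷ xs) (Qx ∷ Qs)  Qs′        | yes _ = Qx ∷ All-filter+filter-∁ P? xs Qs Qs′
All-filter+filter-∁ P? (x ∷ xs) Qs         (Qx ∷ Qs′) | no _  = Qx ∷ All-filter+filter-∁ P? xs Qs Qs′

init-last-elim : ∀ {k} {P : Fin (suc k) → Set} → (∀ i → P (inject₁ i)) → P (fromℕ k) → ∀ i → P i
init-last-elim {zero}  _     P-last zero    = P-last
init-last-elim {suc k} P-init _      zero    = P-init zero
init-last-elim {suc k} P-init P-last (suc i) = init-last-elim (P-init ∘ suc) P-last i

record Class : Set where
  constructor _mod_
  field
    residue : ℤ
    modulus : ℕ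

open Class public

infix 4 _∈ᶜ_ _∈ᶜ?_

-- A record rather than x ≡ b [mod d ], which unfolds to divisibility of absolute values, so that
-- x and c can be inferred.
record _∈ᶜ_ (x : ℤ) (c : Class) : Set where
  constructor in-class
  field
    divides-difference : + modulus c ∣ℤ x ℤ.- residue c

open _∈ᶜ_

_∈ᶜ?_ : ∀ x c → Dec (x ∈ᶜ c)
x ∈ᶜ? c = map′ in-class divides-difference (+ modulus c ℤ∣.∣? x ℤ.- residue c)

≡-mod⇔∈ᶜ : ∀ {x b d} → x ≡ b [mod d ] ⇔ x ∈ᶜ b mod d
≡-mod⇔∈ᶜ {x} {b} {d} = mk⇔ (in-class ∘ ∣ᵤ⇒∣ {+ d} {x ℤ.- b}) (∣⇒∣ᵤ ∘ divides-difference)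

Uncovered : List Class → ℤ → Set
Uncovered cs x = All (λ c → ¬ x ∈ᶜ c) cs

uncovered? : ∀ cs x → Dec (Uncovered cs x)
uncovered? cs x = all? (λ c → ¬? (x ∈ᶜ? c)) cs

uncoveredIn : ℕ → List Class → ℕ
uncoveredIn N cs = count {N} (λ x → uncovered? cs (+ toℕ x))

∈ᶜ-∣ : ∀ {x b d e} → e ∣ d → x ∈ᶜ b mod d → x ∈ᶜ b mod e
∈ᶜ-∣ {d = d} {e} e∣d (in-class d∣x-b) = in-class (ℤ∣.∣-trans (∣ᵤ⇒∣ {+ e} {+ d} e∣d) d∣x-b)

∈ᶜ⇒∣ : ∀ {x z c} → x ∈ᶜ c → z ∈ᶜ c → + modulus c ∣ℤ z ℤ.- x
∈ᶜ⇒∣ {x} {z} {b mod d} (in-class x∈) (in-class z∈) =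
  subst (+ d ∣ℤ_) (difference z x b) (ℤ∣.∣m∣n⇒∣m-n z∈ x∈)
  where
  difference : ∀ z x b → (z ℤ.- b) ℤ.- (x ℤ.- b) ≡ z ℤ.- x
  difference = ℤ-Ring.solve-∀

∈ᶜ-shift : ∀ {d e} i y b → d ∣ e → + (e * i + y) ∈ᶜ b mod d ⇔ + y ∈ᶜ b mod d
∈ᶜ-shift {d} {e} i y b d∣e = mk⇔
  (λ (in-class h) → in-class (ℤ∣.∣m+n∣m⇒∣n (subst (+ d ∣ℤ_) split h) d∣ei))
  (λ (in-class h) → in-class (subst (+ d ∣ℤ_) (sym split) (ℤ∣.∣m∣n⇒∣m+n d∣ei h)))
  where
  d∣ei : + d ∣ℤ + (e * i)
  d∣ei = ∣ᵤ⇒∣ {+ d} {+ (e * i)} (∣m⇒∣m*n i d∣e)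
  split : + (e * i + y) ℤ.- b ≡ + (e * i) ℤ.+ (+ y ℤ.- b)
  split = trans (cong (ℤ._- b) (ℤₚ.pos-+ (e * i) y)) (ℤₚ.+-assoc (+ (e * i)) (+ y) (ℤ.- b))

∣-<⇒≡ : ∀ {d y y′} → y < d → y′ < d → + d ∣ℤ + y ℤ.- + y′ → y ≡ y′
∣-<⇒≡ {d} {y} {y′} y<d y′<d d∣y-y′ =
  ℤₚ.+-injective (ℤₚ.i-j≡0⇒i≡j (+ y) (+ y′)
    (ℤₚ.∣i∣≡0⇒i≡0 (<-divisor⇒≡0 _ ∣y-y′∣<d (∣⇒∣ᵤ d∣y-y′))))
  where
  ∣y-y′∣<d : ∣ + y ℤ.- + y′ ∣ < d
  ∣y-y′∣<d = ≤-<-trans (subst (λ z → ∣ z ∣ ≤ y ⊔ y′) (sym (ℤₚ.m-n≡m⊖n y y′)) (ℤₚ.∣m⊝n∣≤m⊔n y y′))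
                       (⊔-lub y<d y′<d)
  <-divisor⇒≡0 : ∀ z → z < d → d ∣ z → z ≡ 0
  <-divisor⇒≡0 zero    _   _   = refl
  <-divisor⇒≡0 (suc z) z<d d∣z = contradiction (∣⇒≤ d∣z) (<⇒≱ z<d)

∈ᶜ-unique : ∀ {d y y′ b} → y < d → y′ < d → + y ∈ᶜ b mod d → + y′ ∈ᶜ b mod d → y ≡ y′
∈ᶜ-unique y<d y′<d y∈ y′∈ = ∣-<⇒≡ y<d y′<d (∈ᶜ⇒∣ y′∈ y∈)

%ℕ-∈ᶜ : ∀ b d .{{_ : NonZero d}} → + (b %ℕ d) ∈ᶜ b mod d
%ℕ-∈ᶜ b d = in-class (ℤ∣.divides (ℤ.- (b /ℕ d))
  (trans (cong (λ z → + (b %ℕ d) ℤ.- z) (a≡a%ℕn+[a/ℕn]*n b d)) (cancel (+ (b %ℕ d)) (b /ℕ d) (+ d))))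
  where
  cancel : ∀ r q d → r ℤ.- (r ℤ.+ q ℤ.* d) ≡ (ℤ.- q) ℤ.* d
  cancel = ℤ-Ring.solve-∀

count-representatives≡1 : ∀ b d .{{_ : NonZero d}} → count {d} (λ y → + toℕ y ∈ᶜ? b mod d) ≡ 1
count-representatives≡1 b d = ≤-antisym
  (count≤1 representative? (λ y∈ y′∈ →
    Finₚ.toℕ-injective (∈ᶜ-unique (Finₚ.toℕ<n _) (Finₚ.toℕ<n _) y∈ y′∈)))
  (count≥1 representative? (fromℕ< (n%ℕd<d b d))
             (subst (λ y → + y ∈ᶜ b mod d) (sym (Finₚ.toℕ-fromℕ< (n%ℕd<d b d))) (%ℕ-∈ᶜ b d)))
  where
  representative? : ∀ (y : Fin d) → Dec (+ toℕ y ∈ᶜ b mod d)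
  representative? y = + toℕ y ∈ᶜ? b mod d

count-class : ∀ {u d M} b .{{_ : NonZero M}} → u * d ≡ M → count {M} (λ x → + toℕ x ∈ᶜ? b mod d) ≡ u
count-class {u} {d} b refl = begin
  count {u * d} (λ x → + toℕ x ∈ᶜ? b mod d)
    ≡⟨ sum-combine u (λ x → 𝟙 (+ toℕ x ∈ᶜ? b mod d)) ⟩
  ∑[ i < u ] ∑[ y < d ] 𝟙 (+ toℕ (combine i y) ∈ᶜ? b mod d)
    ≡⟨ sum-cong-≗ (λ i → sum-cong-≗ (fibre i)) ⟩
  ∑[ i < u ] count {d} (λ y → + toℕ y ∈ᶜ? b mod d)
    ≡⟨ sum-cong-≗ {u} (λ _ → count-representatives≡1 b d {{m*n≢0⇒n≢0 u}}) ⟩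
  ∑[ i < u ] 1
    ≡⟨ trans (sum-const u 1) (*-identityʳ u) ⟩
  u ∎
  where
  open ≡-Reasoning
  fibre : ∀ (i : Fin u) (y : Fin d) →
    𝟙 (+ toℕ (combine i y) ∈ᶜ? b mod d) ≡ 𝟙 (+ toℕ y ∈ᶜ? b mod d)
  fibre i y rewrite Finₚ.toℕ-combine i y =
    𝟙-cong _ _ (Equivalence.to (∈ᶜ-shift (toℕ i) (toℕ y) b ∣-refl))
               (Equivalence.from (∈ᶜ-shift (toℕ i) (toℕ y) b ∣-refl))

-- Points avoided by finitely many residue classes

module Fibres {p N′ : ℕ} (p-prime : Prime p) .{{_ : NonZero N′}} where

  private instance
    p≢0 : NonZero p
    p≢0 = prime⇒nonZero p-prime

  -- The points of ℤ/pN′ lying over y ∈ ℤ/N′.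
  point : Fin p → Fin N′ → ℤ
  point i y = + (N′ * toℕ i + toℕ y)

  -- The image of b (mod d) in ℤ/N′.
  coarsen : Class → Class
  coarsen (b mod d) = b mod gcd d N′

  ∈ᶜ-coarsen : ∀ {c} i y → point i y ∈ᶜ c → + toℕ y ∈ᶜ coarsen c
  ∈ᶜ-coarsen {b mod d} i y =
    Equivalence.to (∈ᶜ-shift (toℕ i) (toℕ y) b (gcd[m,n]∣n d N′)) ∘ ∈ᶜ-∣ (gcd[m,n]∣m d N′)

  -- d carries the full power of p dividing pN′, so a class mod d meets each fibre at most once.
  Fine : ℕ → Set
  Fine d = ∃ λ q → q * d ≡ p * N′ × ¬ p ∣ q

  unhit⇒fine : ∀ {c} i y → modulus c ∣ p * N′ → + toℕ y ∈ᶜ coarsen c → ¬ point i y ∈ᶜ c →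
    Fine (modulus c)
  unhit⇒fine {b mod d} i y (divides q pN′≡qd) y∈ unhit = q , sym pN′≡qd , p∤q
    where
    p∤q : ¬ p ∣ q
    p∤q (divides r q≡rp) = unhit (Equivalence.from (∈ᶜ-shift (toℕ i) (toℕ y) b d∣N′)
                                    (subst (λ g → + toℕ y ∈ᶜ b mod g) gcd≡d y∈))
      where
      d∣N′ : d ∣ N′
      d∣N′ = divides r (*-cancelˡ-≡ N′ (r * d) p (begin
        p * N′       ≡⟨ pN′≡qd ⟩
        q * d        ≡⟨ cong (_* d) (trans q≡rp (*-comm r p)) ⟩
        p * r * d    ≡⟨ *-assoc p r d ⟩
        p * (r * d)  ∎))
        where open ≡-Reasoning
      gcd≡d : gcd d N′ ≡ d
      gcd≡d = ∣-antisym (gcd[m,n]∣m d N′) (gcd-greatest ∣-refl d∣N′)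

  congruence-solvable : ∀ d z → d ∣ p * N′ → + gcd d N′ ∣ℤ z →
    ∃ λ (i : Fin p) → + d ∣ℤ + (N′ * toℕ i) ℤ.+ z
  congruence-solvable d z d∣pN′ (ℤ∣.divides t z≡tg) with bézout d N′
  ... | u , v , g≡ud+vN′ = fromℕ< (n%ℕd<d w p) , subst (+ d ∣ℤ_) (sym solution) divisible
    where
    w = ℤ.- (t ℤ.* v)
    q = w /ℕ p
    i = w %ℕ p
    N = + N′
    divisible : + d ∣ℤ (ℤ.- q) ℤ.* ((+ p) ℤ.* N) ℤ.+ (t ℤ.* u) ℤ.* (+ d)
    divisible = ℤ∣.∣m∣n⇒∣m+n
      (ℤ∣.∣n⇒∣m*n (ℤ.- q) (subst (+ d ∣ℤ_) (ℤₚ.pos-* p N′)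
        (∣ᵤ⇒∣ {+ d} {+ (p * N′)} d∣pN′)))
      (ℤ∣.∣n⇒∣m*n (t ℤ.* u) ℤ∣.∣-refl)
    expand : ∀ N i t u d v → N ℤ.* i ℤ.+ t ℤ.* (u ℤ.* d ℤ.+ v ℤ.* N)
                             ≡ N ℤ.* (i ℤ.- ℤ.- (t ℤ.* v)) ℤ.+ (t ℤ.* u) ℤ.* d
    expand = ℤ-Ring.solve-∀
    cancel : ∀ i k p → i ℤ.- (i ℤ.+ k ℤ.* p) ≡ (ℤ.- k) ℤ.* p
    cancel = ℤ-Ring.solve-∀
    reorder : ∀ N k p s → N ℤ.* ((ℤ.- k) ℤ.* p) ℤ.+ s ≡ (ℤ.- k) ℤ.* (p ℤ.* N) ℤ.+ s
    reorder = ℤ-Ring.solve-∀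
    solution : + (N′ * toℕ (fromℕ< (n%ℕd<d w p))) ℤ.+ z
             ≡ (ℤ.- q) ℤ.* ((+ p) ℤ.* N) ℤ.+ (t ℤ.* u) ℤ.* (+ d)
    solution = begin
      + (N′ * toℕ (fromℕ< (n%ℕd<d w p))) ℤ.+ z
        ≡⟨ cong₂ ℤ._+_ (trans (cong (λ j → + (N′ * j)) (Finₚ.toℕ-fromℕ< _)) (ℤₚ.pos-* N′ i))
                       z≡tg ⟩
      N ℤ.* (+ i) ℤ.+ t ℤ.* (+ gcd d N′)
        ≡⟨ cong (λ g → N ℤ.* (+ i) ℤ.+ t ℤ.* g) g≡ud+vN′ ⟩
      N ℤ.* (+ i) ℤ.+ t ℤ.* (u ℤ.* (+ d) ℤ.+ v ℤ.* N)
        ≡⟨ expand N (+ i) t u (+ d) v ⟩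
      N ℤ.* ((+ i) ℤ.- w) ℤ.+ (t ℤ.* u) ℤ.* (+ d)
        ≡⟨ cong (λ x → N ℤ.* ((+ i) ℤ.- x) ℤ.+ (t ℤ.* u) ℤ.* (+ d)) (a≡a%ℕn+[a/ℕn]*n w p) ⟩
      N ℤ.* ((+ i) ℤ.- ((+ i) ℤ.+ q ℤ.* (+ p))) ℤ.+ (t ℤ.* u) ℤ.* (+ d)
        ≡⟨ cong (λ x → N ℤ.* x ℤ.+ (t ℤ.* u) ℤ.* (+ d)) (cancel (+ i) q (+ p)) ⟩
      N ℤ.* ((ℤ.- q) ℤ.* (+ p)) ℤ.+ (t ℤ.* u) ℤ.* (+ d)
        ≡⟨ reorder N q (+ p) _ ⟩
      (ℤ.- q) ℤ.* ((+ p) ℤ.* N) ℤ.+ (t ℤ.* u) ℤ.* (+ d)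
        ∎
      where open ≡-Reasoning

  hit-exists : ∀ {c} y → modulus c ∣ p * N′ → + toℕ y ∈ᶜ coarsen c → ∃ λ i → point i y ∈ᶜ c
  hit-exists {b mod d} y d∣pN′ (in-class g∣y-b) =
    let i , d∣ = congruence-solvable d (+ toℕ y ℤ.- b) d∣pN′ g∣y-b
    in i , in-class (subst (+ d ∣ℤ_) (regroup (N′ * toℕ i) (toℕ y)) d∣)
    where
    regroup : ∀ a y → + a ℤ.+ (+ y ℤ.- b) ≡ + (a + y) ℤ.- b
    regroup a y = trans (sym (ℤₚ.+-assoc (+ a) (+ y) (ℤ.- b))) (cong (ℤ._- b) (sym (ℤₚ.pos-+ a y)))

  point≡ : ∀ i y → point i y ≡ (+ N′) ℤ.* (+ toℕ i) ℤ.+ (+ toℕ y)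
  point≡ i y =
    trans (ℤₚ.pos-+ (N′ * toℕ i) (toℕ y)) (cong (ℤ._+ (+ toℕ y)) (ℤₚ.pos-* N′ (toℕ i)))

  point-difference : ∀ i i′ y → point i y ℤ.- point i′ y ≡ (+ N′) ℤ.* (+ toℕ i ℤ.- + toℕ i′)
  point-difference i i′ y = trans (cong₂ ℤ._-_ (point≡ i y) (point≡ i′ y))
                                  (factor (+ N′) (+ toℕ i) (+ toℕ i′) (+ toℕ y))
    where
    factor : ∀ N i i′ y → (N ℤ.* i ℤ.+ y) ℤ.- (N ℤ.* i′ ℤ.+ y) ≡ N ℤ.* (i ℤ.- i′)
    factor = ℤ-Ring.solve-∀

  fine-hits-agree : ∀ {x c c′ y} {i i′ : Fin p} → Fine (modulus c) → Fine (modulus c′) →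
    x ∈ᶜ c → x ∈ᶜ c′ → point i y ∈ᶜ c → point i′ y ∈ᶜ c′ → i ≡ i′
  fine-hits-agree {x} {c} {c′} {y} {i} {i′} (q , qd≡pN′ , p∤q) (q′ , q′d′≡pN′ , p∤q′)
                  x∈c x∈c′ z∈c z′∈c′ =
    Finₚ.toℕ-injective (∣-<⇒≡ (Finₚ.toℕ<n i) (Finₚ.toℕ<n i′) (∣ᵤ⇒∣ {+ p} {I} p∣I))
    where
    N = + N′
    Q = (+ q) ℤ.* (+ q′)
    I = + toℕ i ℤ.- + toℕ i′
    scale : ∀ {d q z} → q * d ≡ p * N′ → + d ∣ℤ z → N ℤ.* (+ p) ∣ℤ z ℤ.* (+ q)
    scale {d} {q} {z} qd≡pN′ (ℤ∣.divides r z≡rd) = ℤ∣.divides r (begin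
      z ℤ.* (+ q)              ≡⟨ cong (ℤ._* (+ q)) z≡rd ⟩
      r ℤ.* (+ d) ℤ.* (+ q)     ≡⟨ ℤₚ.*-assoc r (+ d) (+ q) ⟩
      r ℤ.* ((+ d) ℤ.* (+ q))   ≡⟨ cong (r ℤ.*_) (sym (ℤₚ.pos-* d q)) ⟩
      r ℤ.* + (d * q)           ≡⟨ cong (λ x → r ℤ.* + x) (trans (*-comm d q) qd≡pN′) ⟩
      r ℤ.* + (p * N′)          ≡⟨ cong (λ x → r ℤ.* + x) (*-comm p N′) ⟩
      r ℤ.* + (N′ * p)          ≡⟨ cong (r ℤ.*_) (ℤₚ.pos-* N′ p) ⟩
      r ℤ.* (N ℤ.* (+ p))       ∎)
      where open ≡-Reasoning
    rearrange : ∀ a a′ x q q′ →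
      (a ℤ.- x) ℤ.* q ℤ.* q′ ℤ.- (a′ ℤ.- x) ℤ.* q′ ℤ.* q ≡ (a ℤ.- a′) ℤ.* (q ℤ.* q′)
    rearrange = ℤ-Ring.solve-∀
    factor : ∀ N I Q → N ℤ.* I ℤ.* Q ≡ N ℤ.* (I ℤ.* Q)
    factor = ℤ-Ring.solve-∀
    pN′∣NIQ : N ℤ.* (+ p) ∣ℤ N ℤ.* (I ℤ.* Q)
    pN′∣NIQ = subst (N ℤ.* (+ p) ∣ℤ_)
      (trans (rearrange (point i y) (point i′ y) x (+ q) (+ q′))
             (trans (cong (ℤ._* Q) (point-difference i i′ y)) (factor N I Q)))
      (ℤ∣.∣m∣n⇒∣m-n (ℤ∣.∣m⇒∣m*n (+ q′) (scale qd≡pN′ (∈ᶜ⇒∣ x∈c z∈c)))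
                    (ℤ∣.∣m⇒∣m*n (+ q) (scale q′d′≡pN′ (∈ᶜ⇒∣ x∈c′ z′∈c′))))
    p∤qq′ : ¬ p ∣ q * q′
    p∤qq′ p∣qq′ with euclidsLemma q q′ p-prime p∣qq′
    ... | inj₁ p∣q  = p∤q p∣q
    ... | inj₂ p∣q′ = p∤q′ p∣q′
    p∣I : p ∣ ∣ I ∣
    p∣I = prime∣*⇒∣ p-prime p∤qq′
      (subst (p ∣_) (trans (ℤₚ.abs-* I Q) (cong (∣ I ∣ *_) (ℤₚ.abs-* (+ q) (+ q′))))
             (∣⇒∣ᵤ (ℤ∣.*-cancelˡ-∣ N pN′∣NIQ)))

  module Split (L : List Class) (y₀ : Fin N′) where

    above-y₀? : ∀ c → Dec (+ toℕ y₀ ∈ᶜ coarsen c)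
    above-y₀? c = + toℕ y₀ ∈ᶜ? coarsen c

    hitting : List Class
    hitting = filter above-y₀? L

    projected : List Class
    projected = map coarsen (filter (¬? ∘ above-y₀?) L)

    length-split : length hitting + length projected ≡ length L
    length-split = trans (cong (_+_ (length hitting)) (length-map coarsen (filter (¬? ∘ above-y₀?) L)))
                         (length-filter+filter-∁ above-y₀? L)

    projected-moduli : All (λ c → modulus c ∣ N′) projected
    projected-moduli = map⁺ (All.universal (λ c → gcd[m,n]∣n (modulus c) N′) _)

    projected-uncovered-y₀ : Uncovered projected (+ toℕ y₀)
    projected-uncovered-y₀ = map⁺ (all-filter (¬? ∘ above-y₀?) L)

    uncovered-lift : ∀ {i y} → Uncovered projected (+ toℕ y) → ¬ Any (point i y ∈ᶜ_) hitting →
      Uncovered L (point i y)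
    uncovered-lift {i} {y} unc ¬hit = All-filter+filter-∁ above-y₀? L (¬Any⇒All¬ hitting ¬hit)
      (All.map (λ ¬y∈ z∈ → ¬y∈ (∈ᶜ-coarsen i y z∈)) (map⁻ unc))

    module _ (moduli : All (λ c → modulus c ∣ p * N′) L) (i₀ : Fin p)
             (x₀-uncovered : Uncovered L (point i₀ y₀)) where

      hit? : ∀ y i → Dec (Any (point i y ∈ᶜ_) hitting)
      hit? y i = any? (point i y ∈ᶜ?_) hitting

      hits : Fin N′ → ℕ
      hits y = count (hit? y)

      hitting-fine : All (λ c → Fine (modulus c)) hitting
      hitting-fine = All.zipWith (λ (above , d∣pN′ , unhit) → unhit⇒fine i₀ y₀ d∣pN′ above unhit)
        (all-filter above-y₀? L , All.zip (filter⁺ above-y₀? moduli , filter⁺ above-y₀? x₀-uncovered))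

      hitting-meets-y₀ : All (λ c → ∃ λ i → point i y₀ ∈ᶜ c) hitting
      hitting-meets-y₀ = All.zipWith (λ (above , d∣pN′) → hit-exists y₀ d∣pN′ above)
        (all-filter above-y₀? L , filter⁺ above-y₀? moduli)

      hits-y₀≤ : hits y₀ ≤ length hitting
      hits-y₀≤ = count-any≤length (λ c i → point i y₀ ∈ᶜ? c) hitting
        (All.map (λ fine → count≤1 _ (λ z∈ z′∈ → fine-hits-agree fine fine z∈ z∈ z∈ z′∈))
                 hitting-fine)

      hits-y₀<p : hits y₀ < p
      hits-y₀<p = count<n (hit? y₀) i₀ (All¬⇒¬Any (filter⁺ above-y₀? x₀-uncovered))

      -- A hit over y comes from a class meeting the fibre over y₀; by fine-hits-agree this injects
      -- the hits over y into the hits over y₀.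
      hits≤hits-y₀ : ∀ y → hits y ≤ hits y₀
      hits≤hits-y₀ y = count-≤-by-relation (hit? y₀) (hit? y) shared?
          (λ i → meets-y₀ hitting-meets-y₀) (Any.map proj₁) functional
        where
        Shared : Fin p → Fin p → Set
        Shared i₀′ i = Any (λ c → point i₀′ y₀ ∈ᶜ c × point i y ∈ᶜ c) hitting
        shared? : ∀ i₀′ i → Dec (Shared i₀′ i)
        shared? i₀′ i = any? (λ c → point i₀′ y₀ ∈ᶜ? c ×-dec point i y ∈ᶜ? c) hitting
        meets-y₀ : ∀ {cs i} → All (λ c → ∃ λ i₀′ → point i₀′ y₀ ∈ᶜ c) cs →
          Any (point i y ∈ᶜ_) cs → ∃ λ i₀′ → Any (λ c → point i₀′ y₀ ∈ᶜ c × point i y ∈ᶜ c) cs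
        meets-y₀ ((i₀′ , x∈) ∷ _)  (here z∈)   = i₀′ , here (x∈ , z∈)
        meets-y₀ (_ ∷ meets)       (there any) = Product.map₂ there (meets-y₀ meets any)
        functional : ∀ {i₀′ i i′} → Shared i₀′ i → Shared i₀′ i′ → i ≡ i′
        functional s s′ with All.lookupAny hitting-fine s | All.lookupAny hitting-fine s′
        ... | fine , x∈c , z∈c | fine′ , x∈c′ , z′∈c′ =
          fine-hits-agree fine fine′ x∈c x∈c′ z∈c z′∈c′

      fibre-uncovered : Fin N′ → ℕ
      fibre-uncovered y = count (λ i → uncovered? L (point i y))

      fibre-bound : ∀ y → Uncovered projected (+ toℕ y) → p ∸ hits y₀ ≤ fibre-uncovered y
      fibre-bound y unc = begin
        p ∸ hits y₀                              ≤⟨ ∸-monoˡ-≤ (hits y₀) p≤ ⟩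
        fibre-uncovered y + hits y₀ ∸ hits y₀   ≡⟨ m+n∸n≡m (fibre-uncovered y) (hits y₀) ⟩
        fibre-uncovered y                        ∎
        where
        open ≤-Reasoning
        uncovered-or-hit : ∀ i → Uncovered L (point i y) ⊎ Any (point i y ∈ᶜ_) hitting
        uncovered-or-hit i with hit? y i
        ... | yes hit = inj₂ hit
        ... | no ¬hit = inj₁ (uncovered-lift unc ¬hit)
        p≤ : p ≤ fibre-uncovered y + hits y₀
        p≤ = ≤-trans (count-cover _ (hit? y) uncovered-or-hit)
                     (+-monoʳ-≤ (fibre-uncovered y) (hits≤hits-y₀ y))

      uncoveredIn-fibres : uncoveredIn (p * N′) L ≡ ∑[ y < N′ ] fibre-uncovered y
      uncoveredIn-fibres = trans (sum-combine p (λ x → 𝟙 (uncovered? L (+ toℕ x)))) (trans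
        (sum-cong-≗ {p} (λ i → sum-cong-≗ {N′} (λ y →
          cong (λ x → 𝟙 (uncovered? L (+ x))) (Finₚ.toℕ-combine i y))))
        (∑-comm (λ (i : Fin p) (y : Fin N′) → 𝟙 (uncovered? L (point i y)))))

      uncoveredIn-bound : (p ∸ hits y₀) * uncoveredIn N′ projected ≤ uncoveredIn (p * N′) L
      uncoveredIn-bound = begin
        (p ∸ hits y₀) * uncoveredIn N′ projected              ≡⟨ *-distribˡ-sum {N′} (p ∸ hits y₀) (𝟙 ∘ unc?) ⟩
        ∑[ y < N′ ] ((p ∸ hits y₀) * 𝟙 (unc? y))              ≤⟨ sum-mono-≤ pointwise ⟩
        ∑[ y < N′ ] fibre-uncovered y                         ≡⟨ uncoveredIn-fibres ⟨
        uncoveredIn (p * N′) L                                ∎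
        where
        open ≤-Reasoning
        unc? : ∀ (y : Fin N′) → Dec (Uncovered projected (+ toℕ y))
        unc? y = uncovered? projected (+ toℕ y)
        pointwise : ∀ y → (p ∸ hits y₀) * 𝟙 (unc? y) ≤ fibre-uncovered y
        pointwise y with unc? y
        ... | yes unc = ≤-trans (≤-reflexive (*-identityʳ _)) (fibre-bound y unc)
        ... | no _    = ≤-trans (≤-reflexive (*-zeroʳ (p ∸ hits y₀))) z≤n

      density-step : N′ ≤ 2 ^ length projected * uncoveredIn N′ projected →
        p * N′ ≤ 2 ^ length L * uncoveredIn (p * N′) L
      density-step ih = begin
        p * N′                                 ≤⟨ *-mono-≤ p≤ ih ⟩
        (2 ^ e * (p ∸ e)) * (2 ^ r * U′)        ≡⟨ [m*n]*[o*p]≡[m*o]*[n*p] (2 ^ e) (p ∸ e) (2 ^ r) U′ ⟩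
        (2 ^ e * 2 ^ r) * ((p ∸ e) * U′)        ≤⟨ *-mono-≤ (*-monoˡ-≤ (2 ^ r) (^-monoʳ-≤ 2 hits-y₀≤))
                                                             uncoveredIn-bound ⟩
        (2 ^ h * 2 ^ r) * U                     ≡⟨ cong (_* U) (^-distribˡ-+-* 2 h r) ⟨
        2 ^ (h + r) * U                         ≡⟨ cong (λ l → 2 ^ l * U) length-split ⟩
        2 ^ length L * U                        ∎
        where
        open ≤-Reasoning
        e = hits y₀
        h = length hitting
        r = length projected
        U′ = uncoveredIn N′ projected
        U = uncoveredIn (p * N′) L
        p≤ : p ≤ 2 ^ e * (p ∸ e)
        p≤ = ≤-trans (≤-reflexive (sym (m+[n∸m]≡n (<⇒≤ hits-y₀<p))))
                     (m+n≤2^m*n e (m<n⇒0<n∸m hits-y₀<p))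

uncovered-density : ∀ {N} (L : List Class) → All (λ c → modulus c ∣ N) L →
  (x₀ : Fin N) → Uncovered L (+ toℕ x₀) → N ≤ 2 ^ length L * uncoveredIn N L
uncovered-density {N} L moduli x₀ x₀-uncovered =
  go (factors F) (factorsPrime F) (isFactorisation F) L moduli x₀ x₀-uncovered
  where
  open PrimeFactorisation
  F = factorise N {{Finₚ.nonZeroIndex x₀}}
  go : ∀ ps → All Prime ps → ∀ {N} → N ≡ product ps → ∀ L → All (λ c → modulus c ∣ N) L →
    (x₀ : Fin N) → Uncovered L (+ toℕ x₀) → N ≤ 2 ^ length L * uncoveredIn N L
  go []       _                     refl L _      x₀ x₀-uncovered =
    *-mono-≤ (m^n>0 2 (length L)) (count≥1 (λ x → uncovered? L (+ toℕ x)) x₀ x₀-uncovered)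
  go (p ∷ ps) (p-prime ∷ ps-prime) refl L moduli x₀ x₀-uncovered =
    density-step moduli i₀ x₀-uncovered′
      (go ps ps-prime refl projected projected-moduli y₀ projected-uncovered-y₀)
    where
    instance _ = productOfPrimes≢0 ps-prime
    open Fibres p-prime
    i₀ = proj₁ (remQuot {p} (product ps) x₀)
    y₀ = proj₂ (remQuot {p} (product ps) x₀)
    open Split L y₀
    x₀-uncovered′ : Uncovered L (point i₀ y₀)
    x₀-uncovered′ = subst (Uncovered L ∘ +_)
      (trans (cong toℕ (sym (Finₚ.combine-remQuot {p} (product ps) x₀))) (Finₚ.toℕ-combine i₀ y₀))
      x₀-uncovered

-- The bound for m-systems

module System {k : ℕ} (a : Fin k → ℤ) (n : Fin k → ℕ) where

  class : Fin k → Class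
  class s = a s mod n s

  covering? : ∀ x s → Dec (x ∈ᶜ class s)
  covering? x s = x ∈ᶜ? class s

  multiplicity : ℤ → ℕ
  multiplicity x = count (covering? x)

  coverCount≡multiplicity : ∀ x → coverCount a n x ≡ multiplicity x
  coverCount≡multiplicity x = trans (length-filter-tabulate (λ s → x ≡? a s [mod n s ]) (λ s → s))
    (sum-cong-≗ {k} (λ s → 𝟙-cong (x ≡? a s [mod n s ]) (covering? x s)
                                 (Equivalence.to ≡-mod⇔∈ᶜ) (Equivalence.from ≡-mod⇔∈ᶜ)))

  sum-multiplicity : ∀ {M} .{{_ : NonZero M}} (u : Fin k → ℕ) → (∀ s → u s * n s ≡ M) →
    ∑[ x < M ] multiplicity (+ toℕ x) ≡ sum u
  sum-multiplicity {M} u M≡un = trans (∑-comm (λ (x : Fin M) s → 𝟙 (covering? (+ toℕ x) s)))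
                                      (sum-cong-≗ {k} (λ s → count-class (a s) (M≡un s)))

  selected : (Fin k → Bool) → List Class
  selected J = map class (filter (T? ∘ J) (allFin k))

  selected-uncovered : ∀ {x} (J : Fin k → Bool) → Uncovered (selected J) x →
    ∀ s → T (J s) → ¬ x ∈ᶜ class s
  selected-uncovered J unc s Js = All.lookup (map⁻ unc) (∈-filter⁺ (T? ∘ J) (∈-allFin s) Js)

  length-selected : ∀ J → length (selected J) ≡ count (T? ∘ J)
  length-selected J = trans (length-map class (filter (T? ∘ J) (allFin k)))
                            (length-filter-tabulate (T? ∘ J) (λ s → s))

  module _ {m : ℕ} (m-system : IsMSystem m a n) where

    multiplicity≤m : ∀ x → multiplicity x ≤ m
    multiplicity≤m x = subst (_≤ m) (coverCount≡multiplicity x) (m-system x)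

    deficient-point : ∀ {M} .{{_ : NonZero M}} (u : Fin k → ℕ) → (∀ s → u s * n s ≡ M) →
      sum u ≢ m * M → ∃ λ (x₀ : Fin M) → multiplicity (+ toℕ x₀) < m
    deficient-point {M} u M≡un sum≢ with Finₚ.¬∀⟶∃¬ M _ (λ x → m ≤? multiplicity (+ toℕ x)) saturated
      where
      saturated : ¬ (∀ x → m ≤ multiplicity (+ toℕ x))
      saturated m≤ = sum≢ (begin
        sum u                             ≡⟨ sum-multiplicity u M≡un ⟨
        ∑[ x < M ] multiplicity (+ toℕ x) ≡⟨ sum-cong-≗ (λ x → ≤-antisym (multiplicity≤m _) (m≤ x)) ⟩
        ∑[ x < M ] m                      ≡⟨ sum-const M m ⟩
        M * m                             ≡⟨ *-comm M m ⟩
        m * M                             ∎)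
        where open ≡-Reasoning
    ... | x₀ , m≰ = x₀ , ≰⇒> m≰

    avoiding-classes : ∀ {x₀} → m ≤ suc k → multiplicity x₀ < m →
      ∃ λ J → (∀ s → T (J s) → ¬ x₀ ∈ᶜ class s) × count (T? ∘ J) ≡ suc k ∸ m
    avoiding-classes {x₀} m≤1+k x₀<m = subset-of-size (¬? ∘ covering? x₀) (suc k ∸ m) (begin
      suc k ∸ m                 ≤⟨ ∸-monoʳ-≤ (suc k) x₀<m ⟩
      k ∸ c                     ≡⟨ cong (_∸ c) (count-∁ (covering? x₀)) ⟨
      c + count (¬? ∘ covering? x₀) ∸ c ≡⟨ m+n∸m≡n c _ ⟩
      count (¬? ∘ covering? x₀) ∎)
      where
      open ≤-Reasoning
      c = multiplicity x₀

    multiplicity+uncovered≤m : ∀ {J} → m ≤ suc k → count (T? ∘ J) ≡ suc k ∸ m →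
      ∀ x → multiplicity x + 𝟙 (uncovered? (selected J) x) ≤ m
    multiplicity+uncovered≤m {J} m≤1+k |J| x with uncovered? (selected J) x
    ... | no _    = ≤-trans (≤-reflexive (+-identityʳ _)) (multiplicity≤m x)
    ... | yes unc = +-cancelʳ-≤ (suc k ∸ m) _ _ (begin
      multiplicity x + 1 + (suc k ∸ m)        ≡⟨ cong (_+ (suc k ∸ m)) (+-comm (multiplicity x) 1) ⟩
      suc (multiplicity x + (suc k ∸ m))      ≡⟨ cong (λ e → suc (multiplicity x + e)) |J| ⟨
      suc (multiplicity x + count (T? ∘ J))   ≤⟨ s≤s disjoint ⟩
      suc k                                   ≡⟨ m+[n∸m]≡n m≤1+k ⟨
      m + (suc k ∸ m)                         ∎)
      where
      open ≤-Reasoning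
      disjoint : multiplicity x + count (T? ∘ J) ≤ k
      disjoint = count-disjoint (covering? x) (T? ∘ J) (λ s x∈ Js → selected-uncovered J unc s Js x∈)

    sum+uncovered≤M*m : ∀ {M} .{{_ : NonZero M}} (u : Fin k → ℕ) {J} → m ≤ suc k →
      (∀ s → u s * n s ≡ M) → count (T? ∘ J) ≡ suc k ∸ m → sum u + uncoveredIn M (selected J) ≤ M * m
    sum+uncovered≤M*m {M} u {J} m≤1+k M≡un |J| = begin
      sum u + U                                          ≡⟨ cong (_+ U) (sum-multiplicity u M≡un) ⟨
      ∑[ x < M ] multiplicity (ι x) + U                  ≡⟨ ∑-distrib-+ (multiplicity ∘ ι) (𝟙 ∘ unc? ∘ ι) ⟨
      ∑[ x < M ] (multiplicity (ι x) + 𝟙 (unc? (ι x)))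
        ≤⟨ sum-mono-≤ (multiplicity+uncovered≤m m≤1+k |J| ∘ ι) ⟩
      ∑[ x < M ] m                                       ≡⟨ sum-const M m ⟩
      M * m                                              ∎
      where
      open ≤-Reasoning
      U = uncoveredIn M (selected J)
      ι : Fin M → ℤ
      ι x = + toℕ x
      unc? = uncovered? (selected J)

    m-system-bound : ∀ {M} .{{_ : NonZero M}} (u : Fin k → ℕ) → m ≤ suc k → (∀ s → u s * n s ≡ M) →
      sum u ≢ m * M → sum u * 2 ^ (suc k ∸ m) + M ≤ m * 2 ^ (suc k ∸ m) * M
    m-system-bound {M} u m≤1+k M≡un sum≢ = begin
      sum u * D + M             ≤⟨ +-monoʳ-≤ (sum u * D) density ⟩
      sum u * D + D * U         ≡⟨ cong (_+_ (sum u * D)) (*-comm D U) ⟩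
      sum u * D + U * D         ≡⟨ *-distribʳ-+ D (sum u) U ⟨
      (sum u + U) * D           ≤⟨ *-monoˡ-≤ D (sum+uncovered≤M*m u m≤1+k M≡un |chosen|) ⟩
      M * m * D                 ≡⟨ rearrange M m D ⟩
      m * D * M                 ∎
      where
      open ≤-Reasoning
      D = 2 ^ (suc k ∸ m)
      deficient = deficient-point u M≡un sum≢
      x₀ = proj₁ deficient
      avoiding = avoiding-classes m≤1+k (proj₂ deficient)
      chosen = proj₁ avoiding
      |chosen| = proj₂ (proj₂ avoiding)
      U = uncoveredIn M (selected chosen)
      moduli : All (λ c → modulus c ∣ M) (selected chosen)
      moduli = map⁺ (All.universal (λ s → divides (u s) (sym (M≡un s))) _)
      x₀-uncovered : Uncovered (selected chosen) (+ toℕ x₀)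
      x₀-uncovered = map⁺ (All.map (proj₁ (proj₂ avoiding) _) (all-filter (T? ∘ chosen) (allFin k)))
      density : M ≤ D * U
      density = subst (λ l → M ≤ 2 ^ l * U) (trans (length-selected chosen) |chosen|)
                      (uncovered-density (selected chosen) moduli x₀ x₀-uncovered)
      rearrange : ∀ M m D → M * m * D ≡ m * D * M
      rearrange = ℕ-Ring.solve-∀

-- Common multiples and the extremal case

cofactors : ∀ {k M} {n : Fin k → ℕ} → (∀ s → n s ∣ M) → ∃ λ u → ∀ s → u s * n s ≡ M
cofactors n∣M = (λ s → _∣_.quotient (n∣M s)) , (λ s → sym (_∣_.equality (n∣M s)))

product-common-multiple : ∀ {k} (n : Fin k → ℕ) → (∀ s → 1 ≤ n s) →
  ∃ λ M → NonZero M × ∃ λ u → ∀ s → u s * n s ≡ M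
product-common-multiple n 1≤n =
  product (tabulate n) , product≢0 (tabulate⁺ (>-nonZero ∘ 1≤n)) , cofactors (∈⇒∣product ∘ ∈-tabulate⁺)

sum-cofactors-cross : ∀ {k M M′} {n u u′ : Fin k → ℕ} .{{_ : NonZero M}} →
  (∀ s → u s * n s ≡ M) → (∀ s → u′ s * n s ≡ M′) → sum u * M′ ≡ sum u′ * M
sum-cofactors-cross {k} {M} {M′} {n} {u} {u′} M≡un M′≡u′n = begin
  sum u * M′                 ≡⟨ *-distribʳ-sum M′ u ⟩
  ∑[ s < k ] (u s * M′)       ≡⟨ sum-cong-≗ cross ⟩
  ∑[ s < k ] (u′ s * M)       ≡⟨ *-distribʳ-sum M u′ ⟨
  sum u′ * M                 ∎
  where
  open ≡-Reasoning
  cross : ∀ s → u s * M′ ≡ u′ s * M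
  cross s = *-cancelʳ-≡ (u s * M′) (u′ s * M) (n s) {{*-≡-nonZeroʳ (u s) (M≡un s)}} (begin
    u s * M′ * n s         ≡⟨ swap (u s) M′ (n s) ⟩
    u s * n s * M′         ≡⟨ cong₂ _*_ (M≡un s) (sym (M′≡u′n s)) ⟩
    M * (u′ s * n s)       ≡⟨ rotate M (u′ s) (n s) ⟩
    u′ s * M * n s         ∎)
    where
    swap : ∀ a b c → a * b * c ≡ a * c * b
    swap = ℕ-Ring.solve-∀
    rotate : ∀ a b c → a * (b * c) ≡ b * a * c
    rotate = ℕ-Ring.solve-∀

-- Σ 1/n s = m − 1/2^e, cross-multiplied over an arbitrary common multiple M = u s * n s.
Extremal : ∀ {k} → ℕ → ℕ → (Fin k → ℕ) → Set
Extremal {k} m e n = ∀ {M} .{{_ : NonZero M}} (u : Fin k → ℕ) → (∀ s → u s * n s ≡ M) →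
  sum u * 2 ^ e + M ≡ m * 2 ^ e * M

extremal-at : ∀ {k m e M} {n u : Fin k → ℕ} .{{_ : NonZero M}} →
  (∀ s → u s * n s ≡ M) → sum u * 2 ^ e + M ≡ m * 2 ^ e * M → Extremal m e n
extremal-at {m = m} {e} {M} {n} {u} M≡un extremal-at-M {M′} u′ M′≡u′n =
  *-cancelʳ-≡ (sum u′ * D + M′) (m * D * M′) M (begin
    (sum u′ * D + M′) * M       ≡⟨ expand (sum u′) D M′ M ⟩
    sum u′ * M * D + M′ * M     ≡⟨ cong (λ x → x * D + M′ * M) (sum-cofactors-cross M≡un M′≡u′n) ⟨
    sum u * M′ * D + M′ * M     ≡⟨ expand′ (sum u) M′ D M ⟩
    (sum u * D + M) * M′        ≡⟨ cong (_* M′) extremal-at-M ⟩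
    m * D * M * M′              ≡⟨ swap (m * D) M M′ ⟩
    m * D * M′ * M              ∎)
  where
  open ≡-Reasoning
  D = 2 ^ e
  expand : ∀ s D M′ M → (s * D + M′) * M ≡ s * M * D + M′ * M
  expand = ℕ-Ring.solve-∀
  expand′ : ∀ s M′ D M → s * M′ * D + M′ * M ≡ (s * D + M) * M′
  expand′ = ℕ-Ring.solve-∀
  swap : ∀ a b c → a * b * c ≡ a * c * b
  swap = ℕ-Ring.solve-∀

prime-power-∣-modulus : ∀ {k p e} (n : Fin k → ℕ) → Prime p → (∀ s → 1 ≤ n s) →
  (∀ {M} .{{_ : NonZero M}} (u : Fin k → ℕ) → (∀ s → u s * n s ≡ M) → p ^ suc e ∣ M) →
  ∃ λ s → p ^ suc e ∣ n s
prime-power-∣-modulus {k} {p} {e} n p-prime 1≤n ∣-common-multiples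
  with Finₚ.any? (λ s → p ^ suc e ∣? n s)
... | yes found = found
... | no none   =
  contradiction (∣-common-multiples {{M≢0}} (proj₁ (cofactors n∣M)) (proj₂ (cofactors n∣M))) p^1+e∤M
  where
  instance p≢0 = prime⇒nonZero p-prime
  decomposition : ∀ s → ∃₂ λ v o → n s ≡ p ^ v * o × ¬ p ∣ o
  decomposition s = p-adic p-prime (n s) (1≤n s)
  v o : Fin k → ℕ
  v s = proj₁ (decomposition s)
  o s = proj₁ (proj₂ (decomposition s))
  n≡p^v*o : ∀ s → n s ≡ p ^ v s * o s
  n≡p^v*o s = proj₁ (proj₂ (proj₂ (decomposition s)))
  p∤o : ∀ s → ¬ p ∣ o s
  p∤o s = proj₂ (proj₂ (proj₂ (decomposition s)))
  v≤e : ∀ s → v s ≤ e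
  v≤e s with v s ≤? e
  ... | yes v≤e = v≤e
  ... | no  v≰e = contradiction (s , ∣-trans (^-monoʳ-∣ p (≰⇒> v≰e))
                                      (subst (p ^ v s ∣_) (sym (n≡p^v*o s)) (m∣m*n (o s)))) none
  M = p ^ e * product (tabulate o)
  o≢0 : ∀ s → NonZero (o s)
  o≢0 s = ≢-nonZero (λ o≡0 → p∤o s (subst (p ∣_) (sym o≡0) (p ∣0)))
  M≢0 : NonZero M
  M≢0 = m*n≢0 (p ^ e) _ {{m^n≢0 p e}} {{product≢0 (tabulate⁺ o≢0)}}
  n∣M : ∀ s → n s ∣ M
  n∣M s = subst (_∣ M) (sym (n≡p^v*o s))
            (*-pres-∣ (^-monoʳ-∣ p (v≤e s)) (∈⇒∣product (∈-tabulate⁺ s)))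
  p^1+e∤M : ¬ p ^ suc e ∣ M
  p^1+e∤M p^1+e∣M = prime∤product p-prime (tabulate⁺ p∤o)
    (*-cancelˡ-∣ (p ^ e) {{m^n≢0 p e}} (subst (_∣ M) (*-comm p (p ^ e)) p^1+e∣M))

Sorted : ∀ {k} → (Fin k → ℕ) → Set
Sorted n = ∀ s t → s ≤ᶠ t → n s ≤ n t

sorted-init : ∀ {k} {n : Fin (suc k) → ℕ} → Sorted n → Sorted (init n)
sorted-init sorted s t s≤t =
  sorted (inject₁ s) (inject₁ t)
    (subst₂ _≤_ (sym (Finₚ.toℕ-inject₁ s)) (sym (Finₚ.toℕ-inject₁ t)) s≤t)

IsMSystem-init : ∀ {m k} (a : Fin (suc k) → ℤ) (n : Fin (suc k) → ℕ) →
  IsMSystem m a n → IsMSystem m (init a) (init n)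
IsMSystem-init {m} {k} a n m-system x = begin
  coverCount (init a) (init n) x                         ≡⟨ Init.coverCount≡multiplicity x ⟩
  Init.multiplicity x                                    ≤⟨ m≤m+n _ _ ⟩
  Init.multiplicity x + 𝟙 (Whole.covering? x (fromℕ k))  ≡⟨ sum-init-last (𝟙 ∘ Whole.covering? x) ⟨
  Whole.multiplicity x                                   ≡⟨ Whole.coverCount≡multiplicity x ⟨
  coverCount a n x                                       ≤⟨ m-system x ⟩
  m                                                      ∎
  where
  open ≤-Reasoning
  module Whole = System a n
  module Init = System (init a) (init n)

extremal-base : ∀ {k} (n : Fin k → ℕ) → (∀ s → 1 ≤ n s) → Extremal (suc k) 0 n → ∀ s → n s ≡ 1
extremal-base {k} n 1≤n extremal s =
  *-cancelˡ-≡ (n s) 1 M (trans (cong (_* n s) (sym (u≡M s))) (trans (M≡un s) (sym (*-identityʳ M))))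
  where
  common = product-common-multiple n 1≤n
  M = proj₁ common
  instance M≢0 = proj₁ (proj₂ common)
  u = proj₁ (proj₂ (proj₂ common))
  M≡un = proj₂ (proj₂ (proj₂ common))
  sum≡kM : sum u ≡ k * M
  sum≡kM = +-cancelʳ-≡ M (sum u) (k * M) (begin
    sum u + M                  ≡⟨ cong (_+ M) (*-identityʳ (sum u)) ⟨
    sum u * 1 + M              ≡⟨ extremal u M≡un ⟩
    suc k * 1 * M              ≡⟨ cong (_* M) (*-identityʳ (suc k)) ⟩
    M + k * M                  ≡⟨ +-comm M (k * M) ⟩
    k * M + M                  ∎)
    where open ≡-Reasoning
  u≡M : ∀ s → u s ≡ M
  u≡M = sum≡n*x⇒≡x (λ s → subst (u s ≤_) (M≡un s) (m≤m*n (u s) (n s) {{>-nonZero (1≤n s)}}))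
                    sum≡kM

module _ {k m : ℕ} (a : Fin (suc k) → ℤ) (n : Fin (suc k) → ℕ) (m≤1+k : m ≤ suc k)
         (1≤n : ∀ s → 1 ≤ n s) (m-system : IsMSystem m a n)
         (extremal : Extremal m (suc (suc k ∸ m)) n) where

  private
    D = 2 ^ (suc k ∸ m)
    common = product-common-multiple n 1≤n
    M = proj₁ common
    instance M≢0 = proj₁ (proj₂ common)
    u = proj₁ (proj₂ (proj₂ common))
    M≡un = proj₂ (proj₂ (proj₂ common))
    S = sum (init u)

    split : (S + last u) * (2 * D) + M ≡ m * (2 * D) * M
    split = trans (cong (λ x → x * (2 * D) + M) (sym (sum-init-last u))) (extremal u M≡un)

    prefix-sum≢ : S ≢ m * M
    prefix-sum≢ S≡mM =
      ≢-nonZero⁻¹ M (m+n≡0⇒n≡0 (last u * (2 * D)) (+-cancelˡ-≡ (m * M * (2 * D)) _ 0 (begin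
      m * M * (2 * D) + (last u * (2 * D) + M)   ≡⟨ expand (m * M) (last u) (2 * D) M ⟩
      (m * M + last u) * (2 * D) + M             ≡⟨ cong (λ S → (S + last u) * (2 * D) + M) S≡mM ⟨
      (S + last u) * (2 * D) + M                 ≡⟨ split ⟩
      m * (2 * D) * M                            ≡⟨ swap m (2 * D) M ⟩
      m * M * (2 * D) + 0                        ∎)))
      where
      open ≡-Reasoning
      expand : ∀ x v D M → x * D + (v * D + M) ≡ (x + v) * D + M
      expand = ℕ-Ring.solve-∀
      swap : ∀ m D M → m * D * M ≡ m * M * D + 0
      swap = ℕ-Ring.solve-∀

    M≤last-cofactor : M ≤ last u * (2 * D)
    M≤last-cofactor = +-cancelˡ-≤ (S * (2 * D) + M) M (last u * (2 * D)) (begin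
      S * (2 * D) + M + M                ≡⟨ double S D M ⟩
      2 * (S * D + M)                    ≤⟨ *-monoʳ-≤ 2 prefix-bound ⟩
      2 * (m * D * M)                    ≡⟨ double′ m D M ⟩
      m * (2 * D) * M                    ≡⟨ split ⟨
      (S + last u) * (2 * D) + M         ≡⟨ expand S (last u) (2 * D) M ⟩
      S * (2 * D) + M + last u * (2 * D) ∎)
      where
      open ≤-Reasoning
      prefix-bound : S * D + M ≤ m * D * M
      prefix-bound = System.m-system-bound (init a) (init n) (IsMSystem-init a n m-system) (init u) m≤1+k
                       (M≡un ∘ inject₁) prefix-sum≢
      double : ∀ S D M → S * (2 * D) + M + M ≡ 2 * (S * D + M)
      double = ℕ-Ring.solve-∀
      double′ : ∀ m D M → 2 * (m * D * M) ≡ m * (2 * D) * M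
      double′ = ℕ-Ring.solve-∀
      expand : ∀ S v D M → (S + v) * D + M ≡ S * D + M + v * D
      expand = ℕ-Ring.solve-∀

  last-modulus≤ : last n ≤ 2 * D
  last-modulus≤ = *-cancelˡ-≤ (last u) {{*-≡-nonZeroˡ (last n) (M≡un (fromℕ k))}}
    (≤-trans (≤-reflexive (M≡un (fromℕ k))) M≤last-cofactor)

  last-modulus≡ : Sorted n → last n ≡ 2 * D
  last-modulus≡ sorted = ≤-antisym last-modulus≤
    (≤-trans (∣⇒≤ {{>-nonZero (1≤n s)}} 2D∣n) (sorted s (fromℕ k) (Finₚ.≤fromℕ s)))
    where
    2D∣common-multiples : ∀ {M′} .{{_ : NonZero M′}} u′ → (∀ s → u′ s * n s ≡ M′) →
      2 * D ∣ M′
    2D∣common-multiples {M′} u′ M′≡u′n = ∣m+n∣m⇒∣n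
      (subst (2 * D ∣_) (sym (extremal u′ M′≡u′n)) (∣m⇒∣m*n M′ (n∣m*n m)))
      (n∣m*n (sum u′))
    found = prime-power-∣-modulus {e = suc k ∸ m} n prime[2] 1≤n 2D∣common-multiples
    s = proj₁ found
    2D∣n = proj₂ found

  extremal-init : last n ≡ 2 * D → Extremal m (suc k ∸ m) (init n)
  extremal-init last≡2D =
    extremal-at {m = m} {e = suc k ∸ m} (M≡un ∘ inject₁) (*-cancelˡ-≡ _ _ 2 (begin
    2 * (S * D + M)                            ≡⟨ expand S D M ⟩
    S * (2 * D) + M + M                        ≡⟨ cong (_+_ (S * (2 * D) + M)) last-term ⟨
    S * (2 * D) + M + last u * (2 * D)         ≡⟨ regroup S (last u) (2 * D) M ⟩
    (S + last u) * (2 * D) + M                 ≡⟨ split ⟩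
    m * (2 * D) * M                            ≡⟨ double m D M ⟩
    2 * (m * D * M)                            ∎))
    where
    open ≡-Reasoning
    last-term : last u * (2 * D) ≡ M
    last-term = trans (cong (last u *_) (sym last≡2D)) (M≡un (fromℕ k))
    expand : ∀ S D M → 2 * (S * D + M) ≡ S * (2 * D) + M + M
    expand = ℕ-Ring.solve-∀
    regroup : ∀ S v D M → S * D + M + v * D ≡ (S + v) * D + M
    regroup = ℕ-Ring.solve-∀
    double : ∀ m D M → m * (2 * D) * M ≡ 2 * (m * D * M)
    double = ℕ-Ring.solve-∀

extremal-moduli : ∀ {k m} (a : Fin k → ℤ) (n : Fin k → ℕ) → m ≤ suc k → (∀ s → 1 ≤ n s) →
  Sorted n → IsMSystem m a n → Extremal m (suc k ∸ m) n → ∀ s → n s ≡ 2 ^ (toℕ s + 2 ∸ m)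
extremal-moduli {zero}          a n _      _   _      _        _        ()
extremal-moduli {suc k} {m} a n m≤2+k 1≤n sorted m-system extremal with m≤n⇒m<n∨m≡n m≤2+k
... | inj₂ refl = λ s →
  trans (extremal-base n 1≤n (subst (λ e → Extremal m e n) (n∸n≡0 k) extremal) s)
        (cong (2 ^_) (sym (m≤n⇒m∸n≡0 (s+2≤2+k s))))
  where
  s+2≤2+k : ∀ (s : Fin (suc k)) → toℕ s + 2 ≤ suc (suc k)
  s+2≤2+k s = subst (_≤ suc (suc k)) (+-comm 2 (toℕ s)) (s≤s (s≤s (Finₚ.toℕ≤pred[n] s)))
... | inj₁ m<2+k = init-last-elim
  (λ s → trans (ih s) (cong (λ i → 2 ^ (i + 2 ∸ m)) (sym (Finₚ.toℕ-inject₁ s))))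
  (trans last≡ (cong (2 ^_) exponent))
  where
  m≤1+k = ≤-pred m<2+k
  extremal′ : Extremal m (suc (suc k ∸ m)) n
  extremal′ = subst (λ e → Extremal m e n) (+-∸-assoc 1 m≤1+k) extremal
  last≡ = last-modulus≡ a n m≤1+k 1≤n m-system extremal′ sorted
  ih = extremal-moduli (init a) (init n) m≤1+k (1≤n ∘ inject₁) (sorted-init sorted)
         (IsMSystem-init a n m-system) (extremal-init a n m≤1+k 1≤n m-system extremal′ last≡)
  exponent : suc (suc k ∸ m) ≡ toℕ (fromℕ k) + 2 ∸ m
  exponent = sym (trans (cong (λ i → i + 2 ∸ m) (Finₚ.toℕ-fromℕ k))
                        (trans (cong (_∸ m) (+-comm k 2)) (+-∸-assoc 1 m≤1+k)))

-- Sums of reciprocals as fractions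

infixl 7 _∕_

_∕_ : ℕ → (M : ℕ) → .{{_ : NonZero M}} → ℚᵘ
a ∕ M = + a ℚᵘ./ M

∕-≤ : ∀ {a A b B} .{{_ : NonZero A}} .{{_ : NonZero B}} → a * B ≤ b * A → a ∕ A ≤ᵘ b ∕ B
∕-≤ {a} {suc A} {b} {suc B} aB≤bA =
  *≤* (subst₂ ℤ._≤_ (ℤₚ.pos-* a (suc B)) (ℤₚ.pos-* b (suc A)) (ℤ.+≤+ aB≤bA))

∕-≃⇒ : ∀ {a A b B} .{{_ : NonZero A}} .{{_ : NonZero B}} → a ∕ A ≃ᵘ b ∕ B → a * B ≡ b * A
∕-≃⇒ {a} {suc A} {b} {suc B} (*≡* eq) =
  ℤₚ.+-injective (trans (ℤₚ.pos-* a (suc B)) (trans eq (sym (ℤₚ.pos-* b (suc A)))))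

∕-≃⇐ : ∀ {a A b B} .{{_ : NonZero A}} .{{_ : NonZero B}} → a * B ≡ b * A → a ∕ A ≃ᵘ b ∕ B
∕-≃⇐ {a} {suc A} {b} {suc B} eq =
  *≡* (trans (sym (ℤₚ.pos-* a (suc B))) (trans (cong +_ eq) (ℤₚ.pos-* b (suc A))))

∕-+ : ∀ a b M .{{_ : NonZero M}} → a ∕ M ℚᵘ.+ b ∕ M ≃ᵘ (a + b) ∕ M
∕-+ a b (suc M) = *≡* (trans (factor (+ a) (+ b) (+ suc M))
  (cong₂ ℤ._*_ (sym (ℤₚ.pos-+ a b)) (sym (ℤₚ.pos-* (suc M) (suc M)))))
  where
  factor : ∀ a b M → (a ℤ.* M ℤ.+ b ℤ.* M) ℤ.* M ≡ (a ℤ.+ b) ℤ.* (M ℤ.* M)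
  factor = ℤ-Ring.solve-∀

toℚᵘ-recip : ∀ {u d M} .{{_ : NonZero M}} → u * d ≡ M → ℚ.toℚᵘ (recip d) ≃ᵘ u ∕ M
toℚᵘ-recip {u} {zero}  {M} M≡u*0 = contradiction (trans (sym M≡u*0) (*-zeroʳ u)) (≢-nonZero⁻¹ M)
toℚᵘ-recip {u} {suc d} {M} M≡ud =
  ℚᵘₚ.≃-trans (ℚₚ.toℚᵘ-fromℚᵘ (1 ∕ suc d)) (∕-≃⇐ (trans (+-identityʳ M) (sym M≡ud)))

toℚᵘ-sumRecip : ∀ {k M} (n u : Fin k → ℕ) .{{_ : NonZero M}} → (∀ s → u s * n s ≡ M) →
  ℚ.toℚᵘ (sumRecip n) ≃ᵘ sum u ∕ M
toℚᵘ-sumRecip {k} {M} n u M≡un = partial k (λ s → s)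
  where
  open ℚᵘₚ.≃-Reasoning
  partial : ∀ j (g : Fin j → Fin k) →
    ℚ.toℚᵘ (foldr ℚ._+_ 0ℚ (map (recip ∘ n) (tabulate g))) ≃ᵘ (∑[ i < j ] u (g i)) ∕ M
  partial zero    g = ∕-≃⇐ refl
  partial (suc j) g = begin
    ℚ.toℚᵘ (recip (n (g zero)) ℚ.+ rest)               ≈⟨ ℚₚ.toℚᵘ-homo-+ (recip (n (g zero))) rest ⟩
    ℚ.toℚᵘ (recip (n (g zero))) ℚᵘ.+ ℚ.toℚᵘ rest
      ≈⟨ ℚᵘₚ.+-cong (toℚᵘ-recip (M≡un (g zero))) (partial j (g ∘ suc)) ⟩
    u (g zero) ∕ M ℚᵘ.+ (∑[ i < j ] u (g (suc i))) ∕ M  ≈⟨ ∕-+ (u (g zero)) _ M ⟩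
    (∑[ i < suc j ] u (g i)) ∕ M                       ∎
    where rest = foldr ℚ._+_ 0ℚ (map (recip ∘ n) (tabulate (g ∘ suc)))

toℚᵘ-m-recip : ∀ m D .{{_ : NonZero D}} → 1 ≤ m →
  ℚ.toℚᵘ ((+ m) / 1 - recip D) ≃ᵘ (m * D ∸ 1) ∕ D
toℚᵘ-m-recip m (suc D) 1≤m = begin
  ℚ.toℚᵘ ((+ m) / 1 - recip (suc D))
    ≈⟨ ℚₚ.toℚᵘ-homo-+ ((+ m) / 1) (ℚ.- recip (suc D)) ⟩
  ℚ.toℚᵘ ((+ m) / 1) ℚᵘ.+ ℚ.toℚᵘ (ℚ.- recip (suc D))
    ≈⟨ ℚᵘₚ.+-cong (ℚₚ.toℚᵘ-fromℚᵘ (m ∕ 1)) (ℚₚ.toℚᵘ-homo‿- (recip (suc D))) ⟩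
  m ∕ 1 ℚᵘ.+ ℚᵘ.- ℚ.toℚᵘ (recip (suc D))
    ≈⟨ ℚᵘₚ.+-congʳ (m ∕ 1) (ℚᵘₚ.-‿cong (ℚₚ.toℚᵘ-fromℚᵘ (1 ∕ suc D))) ⟩
  m ∕ 1 ℚᵘ.+ ℚᵘ.- (1 ∕ suc D)
    ≈⟨ *≡* cross ⟩
  (m * suc D ∸ 1) ∕ suc D
    ∎
  where
  open ℚᵘₚ.≃-Reasoning
  mD = + (m * suc D)
  pos-∸1 : + (m * suc D ∸ 1) ≡ mD ℤ.- + 1
  pos-∸1 = sym (trans (ℤₚ.m-n≡m⊖n (m * suc D) 1) (ℤₚ.⊖-≥ (*-mono-≤ 1≤m (s≤s z≤n))))
  cross : ((+ m) ℤ.* + suc D ℤ.+ (ℤ.- + 1) ℤ.* + 1) ℤ.* + suc D ≡ + (m * suc D ∸ 1) ℤ.* + (1 * suc D)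
  cross = trans (normalise (+ m) (+ suc D))
    (cong₂ ℤ._*_ (trans (cong (ℤ._- + 1) (sym (ℤₚ.pos-* m (suc D)))) (sym pos-∸1))
                 (sym (ℤₚ.pos-* 1 (suc D))))
    where
    normalise : ∀ a S →
      (a ℤ.* S ℤ.+ (ℤ.- (+ 1)) ℤ.* (+ 1)) ℤ.* S ≡ (a ℤ.* S ℤ.- (+ 1)) ℤ.* ((+ 1) ℤ.* S)
    normalise = ℤ-Ring.solve-∀

module _ {m k : ℕ} (1≤m : 1 ≤ m) (n : Fin k → ℕ) (1≤n : ∀ s → 1 ≤ n s) where

  private
    D = 2 ^ (suc k ∸ m)
    instance D≢0 = m^n≢0 2 (suc k ∸ m)
    1≤mD : 1 ≤ m * D
    1≤mD = *-mono-≤ 1≤m (m^n>0 2 (suc k ∸ m))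
    common = product-common-multiple n 1≤n
    M = proj₁ common
    instance M≢0 = proj₁ (proj₂ common)
    u = proj₁ (proj₂ (proj₂ common))
    M≡un = proj₂ (proj₂ (proj₂ common))
    sum≃ : ℚ.toℚᵘ (sumRecip n) ≃ᵘ sum u ∕ M
    sum≃ = toℚᵘ-sumRecip n u M≡un
    rhs≃ : ℚ.toℚᵘ ((+ m) / 1 - recip D) ≃ᵘ (m * D ∸ 1) ∕ D
    rhs≃ = toℚᵘ-m-recip m D 1≤m

  sumRecip-bound : ∀ {a} → m ≤ suc k → IsMSystem m a n → sumRecip n ≢ (+ m) / 1 →
    sumRecip n ≤ℚ (+ m) / 1 - recip D
  sumRecip-bound {a} m≤1+k m-system sum≢m = ℚₚ.toℚᵘ-cancel-≤
    (ℚᵘₚ.≤-respˡ-≃ (ℚᵘₚ.≃-sym sum≃)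
    (ℚᵘₚ.≤-respʳ-≃ (ℚᵘₚ.≃-sym rhs≃) (∕-≤ cross-multiplied)))
    where
    sum≢mM : sum u ≢ m * M
    sum≢mM sum≡mM = sum≢m (ℚₚ.toℚᵘ-injective (ℚᵘₚ.≃-trans sum≃ (ℚᵘₚ.≃-trans
      (∕-≃⇐ (trans (*-identityʳ (sum u)) sum≡mM)) (ℚᵘₚ.≃-sym (ℚₚ.toℚᵘ-fromℚᵘ (m ∕ 1))))))
    cross-multiplied : sum u * D ≤ (m * D ∸ 1) * M
    cross-multiplied = +-cancelʳ-≤ M (sum u * D) ((m * D ∸ 1) * M)
      (≤-trans (System.m-system-bound a n m-system u m≤1+k M≡un sum≢mM)
               (≤-reflexive (sym ([x∸1]*y+y≡x*y M 1≤mD))))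

  sumRecip-extremal : sumRecip n ≡ (+ m) / 1 - recip D → Extremal m (suc k ∸ m) n
  sumRecip-extremal sum≡ =
    extremal-at {m = m} {e = suc k ∸ m} M≡un (trans (cong (_+ M) cross-multiplied) ([x∸1]*y+y≡x*y M 1≤mD))
    where
    cross-multiplied : sum u * D ≡ (m * D ∸ 1) * M
    cross-multiplied =
      ∕-≃⇒ (ℚᵘₚ.≃-trans (ℚᵘₚ.≃-sym sum≃) (ℚᵘₚ.≃-trans (ℚₚ.toℚᵘ-cong sum≡) rhs≃))

canonical-cofactor-sum : ∀ {k m} → 1 ≤ m → m ≤ suc k →
  ∑[ s < k ] (2 ^ (suc k ∸ m ∸ (toℕ s + 2 ∸ m))) + 1 ≡ m * 2 ^ (suc k ∸ m)
canonical-cofactor-sum {k} {m} 1≤m m≤1+k with m≤n⇒m<n∨m≡n m≤1+k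
... | inj₂ refl rewrite n∸n≡0 k = begin
  ∑[ s < k ] (2 ^ (0 ∸ (toℕ s + 2 ∸ suc k))) + 1
    ≡⟨ cong (_+ 1) (sum-cong-≗ {k} (λ s → cong (2 ^_) (0∸n≡0 (toℕ s + 2 ∸ suc k)))) ⟩
  ∑[ s < k ] 1 + 1      ≡⟨ cong (_+ 1) (trans (sum-const k 1) (*-identityʳ k)) ⟩
  k + 1                 ≡⟨ +-comm k 1 ⟩
  suc k                 ≡⟨ *-identityʳ (suc k) ⟨
  suc k * 1             ∎
  where open ≡-Reasoning
canonical-cofactor-sum {zero}  (s≤s z≤n) _ | inj₁ (s≤s ())
canonical-cofactor-sum {suc k} {m} 1≤m m≤2+k | inj₁ m<2+k = begin
  ∑[ s < suc k ] (2 ^ (e ∸ x s)) + 1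
    ≡⟨ cong (_+ 1) (sum-init-last (λ s → 2 ^ (e ∸ x s))) ⟩
  ∑[ s < k ] (2 ^ (e ∸ x (inject₁ s))) + 2 ^ (e ∸ x (fromℕ k)) + 1
    ≡⟨ cong₂ (λ a b → a + 2 ^ b + 1) (sum-cong-≗ doubled) last-exponent ⟩
  ∑[ s < k ] (2 * 2 ^ (e′ ∸ x′ s)) + 1 + 1
    ≡⟨ cong (λ a → a + 1 + 1) (*-distribˡ-sum 2 (λ s → 2 ^ (e′ ∸ x′ s))) ⟨
  2 * ∑[ s < k ] (2 ^ (e′ ∸ x′ s)) + 1 + 1
    ≡⟨ twice (∑[ s < k ] (2 ^ (e′ ∸ x′ s))) ⟩
  2 * (∑[ s < k ] (2 ^ (e′ ∸ x′ s)) + 1)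
    ≡⟨ cong (2 *_) (canonical-cofactor-sum 1≤m m≤1+k) ⟩
  2 * (m * 2 ^ e′)
    ≡⟨ swap 2 m (2 ^ e′) ⟩
  m * 2 ^ suc e′
    ≡⟨ cong (λ i → m * 2 ^ i) e≡1+e′ ⟨
  m * 2 ^ e
    ∎
  where
  open ≡-Reasoning
  m≤1+k = ≤-pred m<2+k
  e = suc (suc k) ∸ m
  e′ = suc k ∸ m
  e≡1+e′ : e ≡ suc e′
  e≡1+e′ = +-∸-assoc 1 m≤1+k
  x : Fin (suc k) → ℕ
  x s = toℕ s + 2 ∸ m
  x′ : Fin k → ℕ
  x′ s = toℕ s + 2 ∸ m
  doubled : ∀ s → 2 ^ (e ∸ x (inject₁ s)) ≡ 2 * 2 ^ (e′ ∸ x′ s)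
  doubled s = begin
    2 ^ (e ∸ x (inject₁ s))     ≡⟨ cong (λ i → 2 ^ (e ∸ (i + 2 ∸ m))) (Finₚ.toℕ-inject₁ s) ⟩
    2 ^ (e ∸ x′ s)              ≡⟨ cong (λ i → 2 ^ (i ∸ x′ s)) e≡1+e′ ⟩
    2 ^ (suc e′ ∸ x′ s)         ≡⟨ cong (2 ^_) (+-∸-assoc 1 x′≤e′) ⟩
    2 * 2 ^ (e′ ∸ x′ s)         ∎
    where
    x′≤e′ : x′ s ≤ e′
    x′≤e′ = ∸-monoˡ-≤ m (subst (_≤ suc k) (+-comm 2 (toℕ s)) (s≤s (Finₚ.toℕ<n s)))
  last-exponent : e ∸ x (fromℕ k) ≡ 0
  last-exponent =
    trans (cong (λ i → e ∸ (i ∸ m)) (trans (cong (_+ 2) (Finₚ.toℕ-fromℕ k)) (+-comm k 2))) (n∸n≡0 e)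
  swap : ∀ a b c → a * (b * c) ≡ b * (a * c)
  swap = ℕ-Ring.solve-∀
  twice : ∀ a → 2 * a + 1 + 1 ≡ 2 * (a + 1)
  twice = ℕ-Ring.solve-∀

canonical-sumRecip : ∀ {m k} → 1 ≤ m → m ≤ suc k → (n : Fin k → ℕ) →
  (∀ s → n s ≡ 2 ^ (toℕ s + 2 ∸ m)) → sumRecip n ≡ (+ m) / 1 - recip (2 ^ (suc k ∸ m))
canonical-sumRecip {m} {k} 1≤m m≤1+k n n≡2^x = ℚₚ.toℚᵘ-injective
  (ℚᵘₚ.≃-trans (toℚᵘ-sumRecip n u D≡un)
  (ℚᵘₚ.≃-trans (∕-≃⇐ (cong (_* D) sum≡mD-1)) (ℚᵘₚ.≃-sym (toℚᵘ-m-recip m D 1≤m))))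
  where
  e = suc k ∸ m
  D = 2 ^ e
  instance D≢0 = m^n≢0 2 e
  x : Fin k → ℕ
  x s = toℕ s + 2 ∸ m
  u : Fin k → ℕ
  u s = 2 ^ (e ∸ x s)
  D≡un : ∀ s → u s * n s ≡ D
  D≡un s = begin
    u s * n s              ≡⟨ cong (u s *_) (n≡2^x s) ⟩
    2 ^ (e ∸ x s) * 2 ^ x s  ≡⟨ ^-distribˡ-+-* 2 (e ∸ x s) (x s) ⟨
    2 ^ (e ∸ x s + x s)      ≡⟨ cong (2 ^_) (m∸n+n≡m x≤e) ⟩
    D                        ∎
    where
    open ≡-Reasoning
    x≤e : x s ≤ e
    x≤e = ∸-monoˡ-≤ m (subst (_≤ suc k) (+-comm 2 (toℕ s)) (s≤s (Finₚ.toℕ<n s)))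
  sum≡mD-1 : sum u ≡ m * D ∸ 1
  sum≡mD-1 = trans (sym (m+n∸n≡m (sum u) 1)) (cong (_∸ 1) (canonical-cofactor-sum 1≤m m≤1+k))

theorem1p2 : (m k : ℕ) → 1 ≤ m → m ≤ k →
  (a : Fin k → ℤ) (n : Fin k → ℕ) →
  (∀ s → 1 ≤ n s) →
  (∀ s t → s ≤ᶠ t → n s ≤ n t) →
  IsMSystem m a n →
  sumRecip n ≢ (+ m) / 1 →
  (sumRecip n ≤ℚ ((+ m) / 1 - recip (2 ^ ((k ∸ m) + 1))))
  × ((sumRecip n ≡ (+ m) / 1 - recip (2 ^ ((k ∸ m) + 1)))
     ⇔ (∀ s → n s ≡ 2 ^ ((toℕ s + 2) ∸ m)))
theorem1p2 m k 1≤m m≤k a n 1≤n sorted m-system sum≢m rewrite [k∸m]+1≡1+k∸m m≤k =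
  sumRecip-bound 1≤m n 1≤n m≤1+k m-system sum≢m ,
  mk⇔ (extremal-moduli a n m≤1+k 1≤n sorted m-system ∘ sumRecip-extremal 1≤m n 1≤n)
      (canonical-sumRecip 1≤m m≤1+k n)
  where
  m≤1+k = m≤n⇒m≤1+n m≤k
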